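{- Let $n\geq 1$. Consider the square matrices $A=(A_{ST})$, $B=(B_{ST})$, $\Gamma=(\Gamma_{ST})$ with rows and columns indexed by subsets $S,T\subseteq[n-1]$, where $$A_{ST}=\#\{w\in\mathfrak{S}_n : \overline{S}\subseteq C(w),\ T\subseteq D(w)\},\quad B_{ST}=\#\{w\in\mathfrak{S}_n : \overline{S}\subseteq C(w),\ T= D(w)\},$$ $$\Gamma_{ST}=\#\{w\in\mathfrak{S}_n : C(w)=\overline{S},\ D(w)=T\}.$$ Then $A,B,\Gamma$ are invertible, and writing $N^{ -1}_{ST}$ for the $(S,T)$-entry of $N^{ -1}$, $$A^{ -1}_{ST}=(-1)^{\#S+\#T}A_{ST},\qquad B^{ -1}_{ST}=(-1)^{\#S+\#T}\,\#\{w\in\mathfrak{S}_n : \overline{S}=C(w),\ T\subseteq D(w)\},\qquad \Gamma^{ -1}_{ST}=(-1)^{\#S+\#T}\Gamma_{ST}.$$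
   Context: $[n]=\{1,\dots,n\}$, $\mathfrak{S}_n$ is the set of permutations $w=a_1\cdots a_n$ of $[n]$. For $X\subseteq[n-1]$, $\overline{X}=[n-1]\setminus X$. The descent set is $D(w)=\{i : a_i>a_{i+1}\}$. The connectivity set is $C(w)=\{i\in[n-1] : a_j<a_k \text{ for all } j\leq i<k\}$. -}

module Defs where

open import Data.Bool using (Bool; true; false; if_then_else_)
import Data.Bool as Bool
open import Data.Nat using (ℕ; zero; suc)
import Data.Nat.Properties as ℕP
open import Data.Fin using (Fin; toℕ; inject₁) renaming (suc to fsuc)
import Data.Fin.Properties as FinP
open import Data.Fin.Subset using (Subset; _⊆_; ∁; ∣_∣)
open import Data.Fin.Subset.Properties using (_⊆?_)
open import Data.Integer using (ℤ; +_; -_; _*_; _+_)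
open import Data.List using (List; []; _∷_; [_]; map; concatMap; filter; length; allFin; foldr)
open import Data.Vec using (Vec; lookup; tabulate) renaming ([] to []ᵥ; _∷_ to _∷ᵥ_)
import Data.Vec.Properties as VecP
open import Data.Product using (_×_)
open import Relation.Binary.PropositionalEquality using (_≡_)
open import Relation.Nullary using (Dec)
open import Relation.Nullary.Decidable using (⌊_⌋; _×-dec_; _→-dec_)
open import Relation.Unary using (Decidable)

allVecs : (k n : ℕ) → List (Vec (Fin k) n)
allVecs k zero = [ []ᵥ ]
allVecs k (suc n) = concatMap (λ x → map (x ∷ᵥ_) (allVecs k n)) (allFin k)

IsPerm : {n : ℕ} → Vec (Fin n) n → Set
IsPerm {n} w = (i j : Fin n) → lookup w i ≡ lookup w j → i ≡ j

isPerm? : {n : ℕ} → Decidable (IsPerm {n})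
isPerm? w = FinP.all? (λ i → FinP.all? (λ j →
              (lookup w i FinP.≟ lookup w j) →-dec (i FinP.≟ j)))

Perms : (n : ℕ) → List (Vec (Fin n) n)
Perms n = filter isPerm? (allVecs n n)

countPerms : {n : ℕ} {P : Vec (Fin n) n → Set} → Decidable P → ℕ
countPerms {n} P? = length (filter P? (Perms n))

-- For n = suc m, [n-1] = {1,…,m} is represented by Fin m:
-- the element i : Fin m stands for position (toℕ i + 1) ∈ [n-1].
-- Subsets of [n-1] are Subset m (characteristic vectors).

Des : {m : ℕ} → Vec (Fin (suc m)) (suc m) → Subset m
Des w = tabulate (λ i → ⌊ lookup w (fsuc i) FinP.<? lookup w (inject₁ i) ⌋)

Con : {m : ℕ} → Vec (Fin (suc m)) (suc m) → Subset m
Con w = tabulate (λ i → ⌊ FinP.all? (λ j → FinP.all? (λ k →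
          (toℕ j ℕP.≤? toℕ i) →-dec ((toℕ i ℕP.<? toℕ k) →-dec
            (lookup w j FinP.<? lookup w k)))) ⌋)

_≟ₛ_ : {m : ℕ} (S T : Subset m) → Dec (S ≡ T)
_≟ₛ_ = VecP.≡-dec Bool._≟_

allSubsets : (m : ℕ) → List (Subset m)
allSubsets zero = [ []ᵥ ]
allSubsets (suc m) = concatMap (λ b → map (b ∷ᵥ_) (allSubsets m)) (true ∷ false ∷ [])

Mat : ℕ → Set
Mat m = Subset m → Subset m → ℤ

sumℤ : List ℤ → ℤ
sumℤ = foldr _+_ (+ 0)

_⊗_ : {m : ℕ} → Mat m → Mat m → Mat m
_⊗_ {m} M N S T = sumℤ (map (λ U → M S U * N U T) (allSubsets m))

Id : {m : ℕ} → Mat m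
Id S T = if ⌊ S ≟ₛ T ⌋ then + 1 else + 0

IsInverseOf : {m : ℕ} → Mat m → Mat m → Set
IsInverseOf M N = ((S T : Subset _) → (M ⊗ N) S T ≡ Id S T)
                × ((S T : Subset _) → (N ⊗ M) S T ≡ Id S T)

negOnePow : ℕ → ℤ
negOnePow zero = + 1
negOnePow (suc k) = - negOnePow k

sgn : {m : ℕ} → Subset m → Subset m → ℤ
sgn S T = negOnePow (∣ S ∣ Data.Nat.+ ∣ T ∣)

A : (m : ℕ) → Mat m
A m S T = + countPerms {suc m} (λ w → (∁ S ⊆? Con w) ×-dec (T ⊆? Des w))

B : (m : ℕ) → Mat m
B m S T = + countPerms {suc m} (λ w → (∁ S ⊆? Con w) ×-dec (T ≟ₛ Des w))

Γ : (m : ℕ) → Mat m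
Γ m S T = + countPerms {suc m} (λ w → (Con w ≟ₛ ∁ S) ×-dec (Des w ≟ₛ T))

Ainv : (m : ℕ) → Mat m
Ainv m S T = sgn S T * A m S T

Binv : (m : ℕ) → Mat m
Binv m S T = sgn S T * + countPerms {suc m} (λ w → (∁ S ≟ₛ Con w) ×-dec (T ⊆? Des w))

Γinv : (m : ℕ) → Mat m
Γinv m S T = sgn S T * Γ m S T

{-# OPTIONS --safe #-}

-- Write α(S, T) for A_ST.  For T ⊆ S, a permutation u with ∁S ⊆ C(u) factors uniquely as
-- u = w ∘ v, where v permutes the positions within the blocks cut out by ∁T (equivalently
-- ∁T ⊆ C(v)) and w, which keeps ∁S ⊆ C(w), decreases inside these blocks (T ⊆ D(w)):
-- sort each block of u decreasingly.  Hence α(S, ∅) = α(S, T) · α(T, ∅), and cancelling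
-- α(T, ∅) > 0 gives α(S, S) = 1 and α(S, U) · α(U, T) = [T ⊆ U ⊆ S] · α(S, T).
--
-- With ζ_SU = [U ⊆ S] and Sgn = diag((-1)^|S|), Möbius inversion on the Boolean lattice reads
-- ζ Sgn ζ = Sgn, so the multiplicativity gives A Sgn A = Sgn.  Classifying permutations by
-- C(w) or by D(w) gives A = ζ B′, B = ζ Γ and B′ = Γ ζ, where B′_ST = #{w : ∁S = C(w), T ⊆ D(w)};
-- cancelling the invertible ζ yields Γ Sgn Γ = Sgn, and then B Sgn B′ = Sgn = B′ Sgn B.
-- Finally X Sgn Y = Sgn = Y Sgn X and Sgn² = 1 make Sgn Y Sgn, the matrix with entries
-- (-1)^(|S|+|T|) Y_ST, the inverse of X.

module Submission where

open import Defs
open import Data.Nat using (ℕ)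
open import Data.Product using (_×_; _,_)

module BlockSorting where

  open import Level using (0ℓ)
  open import Data.Nat using (ℕ; zero; suc; _+_; _≤_; _<_; z≤n; s≤s; s≤s⁻¹)
  open import Data.Nat.Properties
  open import Data.Nat.Solver using (module +-*-Solver)
  open import Data.Fin using (Fin; toℕ; fromℕ<; inject₁; opposite; punchOut)
    renaming (zero to fzero; suc to fsuc)
  import Data.Fin.Properties as Fin
  open import Data.Fin.Induction using (<-wellFounded)
  open import Data.Fin.Subset using (Subset; _∈_; _∉_; _⊆_)
  open import Data.Fin.Subset.Properties using (_∈?_)
  open import Data.Product using (∃; Σ-syntax; _×_; _,_)
  open import Data.Sum using (_⊎_; inj₁; inj₂)
  open import Algebra.Properties.Monoid.Sum +-0-monoid using (sum)
  open import Function using (_∘_; id)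
  open import Function.Definitions using (Injective)
  open import Induction.WellFounded using (module All)
  open import Relation.Nullary using (¬_; yes; no; contradiction; contraposition)
  open import Relation.Nullary.Decidable using (_×-dec_)
  open import Relation.Binary using (tri<; tri≈; tri>)
  open import Relation.Binary.PropositionalEquality

  open +-*-Solver using (solve; _:+_; _:=_)

  opposite-reverses-≤ : ∀ {n} {i j : Fin n} → toℕ i ≤ toℕ j → toℕ (opposite j) ≤ toℕ (opposite i)
  opposite-reverses-≤ {n} {i} {j} i≤j = subst₂ _≤_ (sym (Fin.opposite-prop j)) (sym (Fin.opposite-prop i))
    (∸-monoʳ-≤ n (s≤s i≤j))

  opposite-reflects-≤ : ∀ {n} {i j : Fin n} → toℕ (opposite i) ≤ toℕ (opposite j) → toℕ j ≤ toℕ i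
  opposite-reflects-≤ {i = i} {j} le = subst₂ (λ x y → toℕ x ≤ toℕ y)
    (Fin.opposite-involutive j) (Fin.opposite-involutive i) (opposite-reverses-≤ le)

  opposite-injective : ∀ {n} → Injective _≡_ _≡_ (opposite {n})
  opposite-injective {x = i} {j} eq =
    trans (sym (Fin.opposite-involutive i)) (trans (cong opposite eq) (Fin.opposite-involutive j))

  injective⇒existsPivotʳ : ∀ {n} {f : Fin n → Fin n} → Injective _≡_ _≡_ f →
                           ∀ i → ∃ λ k → toℕ i ≤ toℕ k × toℕ (f k) ≤ toℕ i
  injective⇒existsPivotʳ {f = f} f-inj i =
    let j , j≤i′ , i′≤f′j = Fin.injective⇒existsPivot {f = opposite ∘ f ∘ opposite}
                              (opposite-injective ∘ f-inj ∘ opposite-injective) (opposite i)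
    in opposite j
     , opposite-reflects-≤ (subst (λ x → toℕ x ≤ toℕ (opposite i))
                                  (sym (Fin.opposite-involutive j)) j≤i′)
     , opposite-reflects-≤ i′≤f′j

  injective⇒surjective : ∀ {n} {f : Fin (suc n) → Fin (suc n)} → Injective _≡_ _≡_ f →
                         ∀ y → ∃ λ x → f x ≡ y
  injective⇒surjective {n} {f} f-inj y with Fin.any? (λ x → f x Fin.≟ y)
  ... | yes hit = hit
  ... | no miss = contradiction (Fin.injective⇒≤ punched-inj) (1+n≰n {n})
    where
    punched : Fin (suc n) → Fin n
    punched x = punchOut {i = y} (miss ∘ (x ,_) ∘ sym)
    punched-inj : Injective _≡_ _≡_ punched
    punched-inj {x} {x′} =
      f-inj ∘ Fin.punchOut-injective {i = y} (miss ∘ (x ,_) ∘ sym) (miss ∘ (x′ ,_) ∘ sym)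

  clamp : ∀ m → ℕ → Fin (suc m)
  clamp zero    _       = fzero
  clamp (suc m) zero    = fzero
  clamp (suc m) (suc k) = fsuc (clamp m k)

  clamp-toℕ : ∀ {m} (i : Fin (suc m)) → clamp m (toℕ i) ≡ i
  clamp-toℕ {zero}  fzero    = refl
  clamp-toℕ {suc m} fzero    = refl
  clamp-toℕ {suc m} (fsuc i) = cong fsuc (clamp-toℕ i)

  clamp-inject₁ : ∀ {m} (c : Fin m) → clamp m (toℕ c) ≡ inject₁ c
  clamp-inject₁ {suc m} fzero    = refl
  clamp-inject₁ {suc m} (fsuc c) = cong fsuc (clamp-inject₁ c)

  stepwise-decreasing : ∀ (g : ℕ → ℕ) {p q} → (∀ {c} → p ≤ c → c < q → g (suc c) < g c) →
                        p < q → g q < g p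
  stepwise-decreasing g {p} {suc q} step (s≤s p≤q) with m≤n⇒m<n∨m≡n p≤q
  ... | inj₂ refl = step ≤-refl (n<1+n q)
  ... | inj₁ p<q  = <-trans (step p≤q (n<1+n q))
                            (stepwise-decreasing g (λ p≤c c<q → step p≤c (m<n⇒m<1+n c<q)) p<q)

  -- Positions are Fin (suc m) and the cut c : Fin m lies between positions c and c + 1, so
  -- SplitsAt f c and DescentAt f c below say that c ∈ C(f) and c ∈ D(f).
  Separates : ℕ → ℕ → ℕ → Set
  Separates c p q = (p ≤ c × c < q) ⊎ (q ≤ c × c < p)

  module _ {m : ℕ} where

    SplitsAt : (Fin (suc m) → Fin (suc m)) → Fin m → Set
    SplitsAt f c = ∀ j k → toℕ j ≤ toℕ c → toℕ c < toℕ k → toℕ (f j) < toℕ (f k)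

    DescentAt : (Fin (suc m) → Fin (suc m)) → Fin m → Set
    DescentAt f c = toℕ (f (fsuc c)) < toℕ (f (inject₁ c))

    ConnectedOutside : Subset m → (Fin (suc m) → Fin (suc m)) → Set
    ConnectedOutside S f = ∀ c → c ∉ S → SplitsAt f c

    DescendsOn : Subset m → (Fin (suc m) → Fin (suc m)) → Set
    DescendsOn T f = ∀ c → c ∈ T → DescentAt f c

    PreservesCut : (Fin (suc m) → Fin (suc m)) → Fin m → Set
    PreservesCut v c = (∀ j → toℕ j ≤ toℕ c → toℕ (v j) ≤ toℕ c)
                     × (∀ k → toℕ c < toℕ k → toℕ c < toℕ (v k))

    SameBlock : Subset m → ℕ → ℕ → Set
    SameBlock T p q = ∀ c → Separates (toℕ c) p q → c ∈ T

    PreservesBlocks : Subset m → (Fin (suc m) → Fin (suc m)) → Set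
    PreservesBlocks T v = ∀ i → SameBlock T (toℕ i) (toℕ (v i))

    splitsAt⇒¬descentAt : ∀ {f c} → SplitsAt f c → ¬ DescentAt f c
    splitsAt⇒¬descentAt {c = c} splits =
      <-asym (splits (inject₁ c) (fsuc c) (≤-reflexive (Fin.toℕ-inject₁ c)) ≤-refl)

    id-splitsAt : ∀ c → SplitsAt id c
    id-splitsAt c j k j≤c c<k = ≤-<-trans j≤c c<k

    module _ {f g : Fin (suc m) → Fin (suc m)} (f≗g : f ≗ g) where

      injective-resp-≗ : Injective _≡_ _≡_ f → Injective _≡_ _≡_ g
      injective-resp-≗ f-inj {i} {j} eq = f-inj (trans (f≗g i) (trans eq (sym (f≗g j))))

      connectedOutside-resp-≗ : ∀ {S} → ConnectedOutside S f → ConnectedOutside S g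
      connectedOutside-resp-≗ connected c c∉S j k j≤c c<k =
        subst₂ (λ x y → toℕ x < toℕ y) (f≗g j) (f≗g k) (connected c c∉S j k j≤c c<k)

      descendsOn-resp-≗ : ∀ {T} → DescendsOn T f → DescendsOn T g
      descendsOn-resp-≗ descends c c∈T = subst₂ (λ x y → toℕ x < toℕ y) (f≗g _) (f≗g _) (descends c c∈T)

    module _ {v : Fin (suc m) → Fin (suc m)} {c : Fin m} where

      preservesCut⇒splitsAt : PreservesCut v c → SplitsAt v c
      preservesCut⇒splitsAt (left , right) j k j≤c c<k = ≤-<-trans (left j j≤c) (right k c<k)

      splitsAt-∘ : ∀ {w} → PreservesCut v c → SplitsAt w c → SplitsAt (w ∘ v) c
      splitsAt-∘ (left , right) w-splits j k j≤c c<k = w-splits (v j) (v k) (left j j≤c) (right k c<k)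

      -- Every injection has pivots j ≤ c ≤ v j and k ≥ c + 1 ≥ v k; they bound v on either side of the cut.
      splitsAt⇒preservesCut : Injective _≡_ _≡_ v → SplitsAt v c → PreservesCut v c
      splitsAt⇒preservesCut v-inj v-splits = left , right
        where
        left : ∀ j → toℕ j ≤ toℕ c → toℕ (v j) ≤ toℕ c
        left j j≤c with injective⇒existsPivotʳ v-inj (fsuc c)
        ... | k , c<k , vk≤1+c = s≤s⁻¹ (≤-trans (v-splits j k j≤c c<k) vk≤1+c)
        right : ∀ k → toℕ c < toℕ k → toℕ c < toℕ (v k)
        right k c<k with Fin.injective⇒existsPivot v-inj (inject₁ c)
        ... | j , j≤c , c≤vj = ≤-<-trans (subst (_≤ toℕ (v j)) (Fin.toℕ-inject₁ c) c≤vj)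
                                         (v-splits j k (subst (toℕ j ≤_) (Fin.toℕ-inject₁ c) j≤c) c<k)

    module _ {T : Subset m} where

      sameBlock-refl : ∀ p → SameBlock T p p
      sameBlock-refl p c (inj₁ (p≤c , c<p)) = contradiction p≤c (<⇒≱ c<p)
      sameBlock-refl p c (inj₂ (p≤c , c<p)) = contradiction p≤c (<⇒≱ c<p)

      sameBlock-sym : ∀ {p q} → SameBlock T p q → SameBlock T q p
      sameBlock-sym same c (inj₁ sep) = same c (inj₂ sep)
      sameBlock-sym same c (inj₂ sep) = same c (inj₁ sep)

      sameBlock-trans : ∀ {p q r} → SameBlock T p q → SameBlock T q r → SameBlock T p r
      sameBlock-trans {q = q} pq qr c (inj₁ (p≤c , c<r)) with toℕ c <? q
      ... | yes c<q = pq c (inj₁ (p≤c , c<q))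
      ... | no c≮q  = qr c (inj₁ (≮⇒≥ c≮q , c<r))
      sameBlock-trans {q = q} pq qr c (inj₂ (r≤c , c<p)) with toℕ c <? q
      ... | yes c<q = qr c (inj₂ (r≤c , c<q))
      ... | no c≮q  = pq c (inj₂ (≮⇒≥ c≮q , c<p))

      module _ {v : Fin (suc m) → Fin (suc m)} where

        preservesCuts⇒preservesBlocks : (∀ c → c ∉ T → PreservesCut v c) → PreservesBlocks T v
        preservesCuts⇒preservesBlocks preserves i c sep with c ∈? T
        ... | yes c∈T = c∈T
        ... | no c∉T with preserves c c∉T | sep
        ...   | left , _  | inj₁ (i≤c , c<vi) = contradiction (left i i≤c) (<⇒≱ c<vi)
        ...   | _ , right | inj₂ (vi≤c , c<i) = contradiction (right i c<i) (≤⇒≯ vi≤c)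

        preservesBlocks⇒preservesCut : PreservesBlocks T v → ∀ {c} → c ∉ T → PreservesCut v c
        preservesBlocks⇒preservesCut blocks {c} c∉T = left , right
          where
          left : ∀ j → toℕ j ≤ toℕ c → toℕ (v j) ≤ toℕ c
          left j j≤c with toℕ (v j) ≤? toℕ c
          ... | yes vj≤c = vj≤c
          ... | no vj≰c  = contradiction (blocks j c (inj₁ (j≤c , ≰⇒> vj≰c))) c∉T
          right : ∀ k → toℕ c < toℕ k → toℕ c < toℕ (v k)
          right k c<k with toℕ c <? toℕ (v k)
          ... | yes c<vk = c<vk
          ... | no c≮vk  = contradiction (blocks k c (inj₂ (≮⇒≥ c≮vk , c<k))) c∉T

        connectedOutside⇒preservesBlocks : Injective _≡_ _≡_ v → ConnectedOutside T v → PreservesBlocks T v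
        connectedOutside⇒preservesBlocks v-inj connected =
          preservesCuts⇒preservesBlocks (λ c c∉T → splitsAt⇒preservesCut v-inj (connected c c∉T))

        preservesBlocks⇒connectedOutside : PreservesBlocks T v → ConnectedOutside T v
        preservesBlocks⇒connectedOutside blocks c c∉T =
          preservesCut⇒splitsAt (preservesBlocks⇒preservesCut blocks c∉T)

        connectedOutside-∘ : ∀ {S w} → T ⊆ S → ConnectedOutside S w → PreservesBlocks T v →
                             ConnectedOutside S (w ∘ v)
        connectedOutside-∘ T⊆S connected blocks c c∉S =
          splitsAt-∘ (preservesBlocks⇒preservesCut blocks (contraposition T⊆S c∉S)) (connected c c∉S)

      descent-within-block : ∀ {w} → DescendsOn T w →
                             ∀ {p q} → toℕ p < toℕ q → SameBlock T (toℕ p) (toℕ q) → toℕ (w q) < toℕ (w p)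
      descent-within-block {w} descends {p} {q} p<q same =
        subst₂ _<_ (cong (toℕ ∘ w) (clamp-toℕ q)) (cong (toℕ ∘ w) (clamp-toℕ p))
          (stepwise-decreasing (toℕ ∘ w ∘ clamp m) step p<q)
        where
        cut : ∀ {c} → c < toℕ q → c < m
        cut c<q = <-≤-trans c<q (s≤s⁻¹ (Fin.toℕ<n q))
        step : ∀ {c} → toℕ p ≤ c → c < toℕ q → toℕ (w (clamp m (suc c))) < toℕ (w (clamp m c))
        step {c} p≤c c<q with fromℕ< (cut c<q) | Fin.toℕ-fromℕ< (cut c<q)
        ... | c′ | refl = subst₂ (λ x y → toℕ (w x) < toℕ (w y))
                            (sym (clamp-toℕ (fsuc c′))) (sym (clamp-inject₁ c′))
                            (descends c′ (same c′ (inj₁ (p≤c , c<q))))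

      -- With k = v i, the position v′ i lies in the block of k: left of k it contradicts the
      -- injectivity of w, right of k the descents of w′ give w k = w′ (v′ i) < w′ k.
      agree-below⇒≤ : ∀ {w w′ v v′} → Injective _≡_ _≡_ w → Injective _≡_ _≡_ v →
                      PreservesBlocks T v → PreservesBlocks T v′ → DescendsOn T w′ →
                      (∀ i → w (v i) ≡ w′ (v′ i)) →
                      ∀ k → (∀ {j} → toℕ j < toℕ k → w j ≡ w′ j) → toℕ (w k) ≤ toℕ (w′ k)
      agree-below⇒≤ {w} {w′} {v} {v′} w-inj v-inj v-blocks v′-blocks w′-desc agree k below
        with injective⇒surjective v-inj k
      ... | i , refl with <-cmp (toℕ (v′ i)) (toℕ (v i))
      ...   | tri< v′i<vi _ _ =
        contradiction (w-inj (trans (agree i) (sym (below v′i<vi)))) (<⇒≢ v′i<vi ∘ cong toℕ ∘ sym)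
      ...   | tri≈ _ v′i≡vi _ = ≤-reflexive (cong toℕ (trans (agree i) (cong w′ (Fin.toℕ-injective v′i≡vi))))
      ...   | tri> _ _ vi<v′i = <⇒≤ (subst (λ x → toℕ x < toℕ (w′ (v i))) (sym (agree i))
                                      (descent-within-block {w′} w′-desc vi<v′i
                                        (sameBlock-trans (sameBlock-sym (v-blocks i)) (v′-blocks i))))

      factorisation-unique : ∀ {w w′ v v′} → Injective _≡_ _≡_ w → Injective _≡_ _≡_ w′ →
                             Injective _≡_ _≡_ v → Injective _≡_ _≡_ v′ →
                             PreservesBlocks T v → PreservesBlocks T v′ → DescendsOn T w → DescendsOn T w′ →
                             (∀ i → w (v i) ≡ w′ (v′ i)) → ∀ k → w k ≡ w′ k
      factorisation-unique {w} {w′} w-inj w′-inj v-inj v′-inj v-blocks v′-blocks w-desc w′-desc agree =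
        All.wfRec <-wellFounded 0ℓ (λ k → w k ≡ w′ k) λ k below → Fin.toℕ-injective (≤-antisym
          (agree-below⇒≤ w-inj v-inj v-blocks v′-blocks w′-desc agree k below)
          (agree-below⇒≤ w′-inj v′-inj v′-blocks v-blocks w-desc (sym ∘ agree) k (sym ∘ below)))

  fsuc≢inject₁ : ∀ {m} (c : Fin m) → fsuc c ≢ inject₁ c
  fsuc≢inject₁ c eq = 1+n≢n (trans (cong toℕ eq) (Fin.toℕ-inject₁ c))

  swap : ∀ {m} → Fin m → Fin (suc m) → Fin (suc m)
  swap fzero    fzero           = fsuc fzero
  swap fzero    (fsuc fzero)    = fzero
  swap fzero    (fsuc (fsuc k)) = fsuc (fsuc k)
  swap (fsuc t) fzero           = fzero
  swap (fsuc t) (fsuc k)        = fsuc (swap t k)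

  swap-involutive : ∀ {m} (t : Fin m) k → swap t (swap t k) ≡ k
  swap-involutive fzero    fzero           = refl
  swap-involutive fzero    (fsuc fzero)    = refl
  swap-involutive fzero    (fsuc (fsuc k)) = refl
  swap-involutive (fsuc t) fzero           = refl
  swap-involutive (fsuc t) (fsuc k)        = cong fsuc (swap-involutive t k)

  swap-injective : ∀ {m} (t : Fin m) → Injective _≡_ _≡_ (swap t)
  swap-injective t {j} {k} eq = trans (sym (swap-involutive t j)) (trans (cong (swap t) eq) (swap-involutive t k))

  swap-preservesCut : ∀ {m} {t c : Fin m} → c ≢ t → PreservesCut (swap t) c
  swap-preservesCut c≢t = left c≢t , right c≢t
    where
    left : ∀ {m} {t c : Fin m} → c ≢ t → ∀ j → toℕ j ≤ toℕ c → toℕ (swap t j) ≤ toℕ c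
    left {t = fzero}  {fzero}  c≢t _ _ = contradiction refl c≢t
    left {t = fzero}  {fsuc c} _ fzero           _   = s≤s z≤n
    left {t = fzero}  {fsuc c} _ (fsuc fzero)    _   = z≤n
    left {t = fzero}  {fsuc c} _ (fsuc (fsuc j)) j≤c = j≤c
    left {t = fsuc t} {fzero}  _ fzero           _   = z≤n
    left {t = fsuc t} {fsuc c} _ fzero           _   = z≤n
    left {t = fsuc t} {fsuc c} c≢t (fsuc j) (s≤s j≤c) = s≤s (left (c≢t ∘ cong fsuc) j j≤c)
    right : ∀ {m} {t c : Fin m} → c ≢ t → ∀ k → toℕ c < toℕ k → toℕ c < toℕ (swap t k)
    right {t = fzero}  {fzero}  c≢t _ _ = contradiction refl c≢t
    right {t = fzero}  {fsuc c} _ (fsuc (fsuc k)) c<k = c<k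
    right {t = fzero}  {fsuc c} _ fzero ()
    right {t = fzero}  {fsuc c} _ (fsuc fzero) (s≤s ())
    right {t = fsuc t} {_}      _ fzero ()
    right {t = fsuc t} {fzero}  _ (fsuc k) _ = s≤s z≤n
    right {t = fsuc t} {fsuc c} c≢t (fsuc k) (s≤s c<k) = s≤s (right (c≢t ∘ cong fsuc) k c<k)

  sum-swap : ∀ {m} (t : Fin m) (f : Fin (suc m) → ℕ) → sum (f ∘ swap t) ≡ sum f
  sum-swap fzero    f =
    solve 3 (λ a b c → b :+ (a :+ c) := a :+ (b :+ c)) refl (f fzero) (f (fsuc fzero)) (sum (f ∘ fsuc ∘ fsuc))
  sum-swap (fsuc t) f = cong (f fzero +_) (sum-swap t (f ∘ fsuc))

  -- Σₚ p · f p, computed via Σₚ p · f p = Σₚ f (p + 1) + Σₚ p · f (p + 1).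
  weightedSum : ∀ {n} → (Fin n → ℕ) → ℕ
  weightedSum {zero}  f = 0
  weightedSum {suc n} f = sum (f ∘ fsuc) + weightedSum (f ∘ fsuc)

  weightedSum-swap : ∀ {m} (t : Fin m) (f : Fin (suc m) → ℕ) →
                     weightedSum (f ∘ swap t) + f (fsuc t) ≡ weightedSum f + f (inject₁ t)
  weightedSum-swap fzero f = solve 4 (λ a b x y → ((a :+ x) :+ (x :+ y)) :+ b := ((b :+ x) :+ (x :+ y)) :+ a) refl
    (f fzero) (f (fsuc fzero)) (sum (f ∘ fsuc ∘ fsuc)) (weightedSum (f ∘ fsuc ∘ fsuc))
  weightedSum-swap {suc m} (fsuc t) f = begin
    sum (g ∘ swap t) + weightedSum (g ∘ swap t) + g (fsuc t)
      ≡⟨ +-assoc (sum (g ∘ swap t)) _ _ ⟩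
    sum (g ∘ swap t) + (weightedSum (g ∘ swap t) + g (fsuc t))
      ≡⟨ cong₂ _+_ (sum-swap t g) (weightedSum-swap t g) ⟩
    sum g + (weightedSum g + g (inject₁ t))
      ≡⟨ +-assoc (sum g) _ _ ⟨
    sum g + weightedSum g + g (inject₁ t) ∎
    where
    open ≡-Reasoning
    g : Fin (suc m) → ℕ
    g = f ∘ fsuc

  record Factorisation {m} (S T : Subset m) (u : Fin (suc m) → Fin (suc m)) : Set where
    field
      left right      : Fin (suc m) → Fin (suc m)
      left-injective  : Injective _≡_ _≡_ left
      right-injective : Injective _≡_ _≡_ right
      left-connected  : ConnectedOutside S left
      right-blocks    : PreservesBlocks T right
      composes        : ∀ i → left (right i) ≡ u i

  module _ {m : ℕ} {S T : Subset m} (T⊆S : T ⊆ S) {u : Fin (suc m) → Fin (suc m)} where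

    open Factorisation

    swap-preservesBlocks : ∀ {t} → t ∈ T → PreservesBlocks T (swap t)
    swap-preservesBlocks t∈T =
      preservesCuts⇒preservesBlocks λ c c∉T → swap-preservesCut λ { refl → c∉T t∈T }

    swap-ascent : ∀ {t} → t ∈ T → Factorisation S T u → Factorisation S T u
    swap-ascent {t} t∈T F = record
      { left            = left F ∘ swap t
      ; right           = swap t ∘ right F
      ; left-injective  = swap-injective t ∘ left-injective F
      ; right-injective = right-injective F ∘ swap-injective t
      ; left-connected  = λ c c∉S →
          splitsAt-∘ (swap-preservesCut λ { refl → c∉S (T⊆S t∈T) }) (left-connected F c c∉S)
      ; right-blocks    = λ i → sameBlock-trans (right-blocks F i) (swap-preservesBlocks t∈T (right F i))
      ; composes        = λ i → trans (cong (left F) (swap-involutive t (right F i))) (composes F i)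
      }

    weight : Factorisation S T u → ℕ
    weight F = weightedSum (toℕ ∘ left F)

    swap-ascent-decreases : ∀ {t} (t∈T : t ∈ T) F → toℕ (left F (inject₁ t)) < toℕ (left F (fsuc t)) →
                            weight (swap-ascent t∈T F) < weight F
    swap-ascent-decreases {t} t∈T F ascent = +-cancelʳ-< (toℕ (left F (fsuc t))) _ _
      (subst (_< weight F + toℕ (left F (fsuc t))) (sym (weightedSum-swap t (toℕ ∘ left F)))
        (+-monoʳ-< (weight F) ascent))

    -- Bubble sort within the T-blocks.
    sort-blocks : ∀ n (F : Factorisation S T u) → weight F < n →
                  Σ[ F ∈ Factorisation S T u ] DescendsOn T (left F)
    sort-blocks (suc n) F bound
      with Fin.any? (λ t → t ∈? T ×-dec toℕ (left F (inject₁ t)) <? toℕ (left F (fsuc t)))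
    ... | yes (t , t∈T , ascent) =
      sort-blocks n (swap-ascent t∈T F) (<-≤-trans (swap-ascent-decreases t∈T F ascent) (s≤s⁻¹ bound))
    ... | no no-ascent = F , descends
      where
      descends : DescendsOn T (left F)
      descends c c∈T with toℕ (left F (inject₁ c)) <? toℕ (left F (fsuc c))
      ... | yes ascent = contradiction (c , c∈T , ascent) no-ascent
      ... | no ¬ascent = ≤∧≢⇒< (≮⇒≥ ¬ascent) (fsuc≢inject₁ c ∘ left-injective F ∘ Fin.toℕ-injective)

    factorise : Injective _≡_ _≡_ u → ConnectedOutside S u →
                Σ[ F ∈ Factorisation S T u ] DescendsOn T (left F)
    factorise u-inj u-connected = sort-blocks _ unsorted (n<1+n _)
      where
      unsorted : Factorisation S T u
      unsorted = record
        { left            = u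
        ; right           = id
        ; left-injective  = u-inj
        ; right-injective = id
        ; left-connected  = u-connected
        ; right-blocks    = λ i → sameBlock-refl (toℕ i)
        ; composes        = λ i → refl
        }


module Counting where

  open BlockSorting
  open import Data.Bool.Properties using (T-≡)
  open import Data.Nat using (ℕ; zero; suc; _+_; _*_; _≤_; _<_; z≤n; s≤s; >-nonZero)
  open import Data.Nat.Properties
  open import Data.Fin using (Fin)
  import Data.Fin.Properties as Fin
  open import Data.Fin.Subset using (Subset; _⊆_; ∁; ⊥) renaming (_∈_ to _∈ₛ_)
  open import Data.Fin.Subset.Properties using (_⊆?_; _∈?_; ⊥⊆; x∈∁p⇒x∉p; x∉p⇒x∈∁p)
  open import Data.Vec using (Vec; lookup; tabulate)
    renaming ([] to []ᵥ; _∷_ to _∷ᵥ_; map to mapᵥ)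
  import Data.Vec.Properties as Vec
  open import Data.List
    using (List; []; _∷_; _++_; map; concatMap; filter; length; allFin;
           cartesianProduct; cartesianProductWith)
  open import Data.List.Properties using (length-map; length-++; filter-notAll; filter-none)
  open import Data.List.Membership.Propositional using (_∈_)
  open import Data.List.Membership.Propositional.Properties
    using (∈-filter⁺; ∈-filter⁻; ∈-map⁺; ∈-allFin;
           ∈-cartesianProduct⁺; ∈-cartesianProduct⁻; ∈-cartesianProductWith⁺)
  open import Data.List.Relation.Unary.Any using (here; there)
  import Data.List.Relation.Unary.Any as Any
  import Data.List.Relation.Unary.All as All
  open import Data.List.Relation.Unary.AllPairs using ([]; _∷_)
  open import Data.List.Relation.Unary.Unique.Propositional using (Unique)
  import Data.List.Relation.Unary.Unique.Propositional.Properties as Unique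
  open import Data.Product using (∃; _×_; _,_; proj₂)
  open import Function using (_∘_; id; Equivalence)
  open import Function.Definitions using (Injective)
  open import Relation.Nullary using (¬_; ¬?; yes; no; contradiction)
  open import Relation.Nullary.Decidable using (⌊_⌋; _×-dec_; fromWitness; toWitness)
  open import Relation.Unary using (Decidable)
  open import Relation.Binary using (DecidableEquality)
  open import Relation.Binary.PropositionalEquality

  module _ {B : Set} (_≟_ : DecidableEquality B) where

    injectiveOn⇒length≤ : {A : Set} (f : A → B) {xs : List A} {ys : List B} → Unique xs →
                          (∀ {x y} → x ∈ xs → y ∈ xs → f x ≡ f y → x ≡ y) →
                          (∀ {x} → x ∈ xs → f x ∈ ys) → length xs ≤ length ys
    injectiveOn⇒length≤ f {[]}     _                  _   _    = z≤n
    injectiveOn⇒length≤ f {x ∷ xs} {ys} (x∉xs ∷ unique) inj into =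
      <-≤-trans (s≤s (injectiveOn⇒length≤ f unique (λ p q → inj (there p) (there q)) into′))
                (filter-notAll (¬? ∘ (_≟ f x)) ys
                   (Any.map (λ { refl ¬fx≡fx → ¬fx≡fx refl }) (into (here refl))))
      where
      into′ : ∀ {y} → y ∈ xs → f y ∈ filter (¬? ∘ (_≟ f x)) ys
      into′ y∈xs = ∈-filter⁺ _ (into (there y∈xs))
        (λ fy≡fx → All.lookup x∉xs y∈xs (sym (inj (there y∈xs) (here refl) fy≡fx)))

    bijectiveOn⇒length≡ : {A : Set} (f : A → B) {xs : List A} {ys : List B} → Unique xs → Unique ys →
                          (∀ {x y} → x ∈ xs → y ∈ xs → f x ≡ f y → x ≡ y) →
                          (∀ {x} → x ∈ xs → f x ∈ ys) →
                          (∀ {y} → y ∈ ys → ∃ λ x → x ∈ xs × f x ≡ y) →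
                          length xs ≡ length ys
    bijectiveOn⇒length≡ f {xs} {ys} unique-xs unique-ys inj into onto = ≤-antisym
      (injectiveOn⇒length≤ f unique-xs inj into)
      (subst (length ys ≤_) (length-map f xs) (injectiveOn⇒length≤ id unique-ys (λ _ _ → id) image))
      where
      image : ∀ {y} → y ∈ ys → y ∈ map f xs
      image y∈ys with onto y∈ys
      ... | x , x∈xs , refl = ∈-map⁺ f x∈xs

  length-cartesianProduct : {A B : Set} (xs : List A) (ys : List B) →
                            length (cartesianProduct xs ys) ≡ length xs * length ys
  length-cartesianProduct []       ys = refl
  length-cartesianProduct (x ∷ xs) ys = trans (length-++ (map (x ,_) ys))
    (cong₂ _+_ (length-map (x ,_) ys) (length-cartesianProduct xs ys))

  allVecs-suc : ∀ k n → allVecs k (suc n) ≡ cartesianProductWith _∷ᵥ_ (allFin k) (allVecs k n)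
  allVecs-suc k n = go (allFin k)
    where
    go : ∀ xs → concatMap (λ x → map (x ∷ᵥ_) (allVecs k n)) xs ≡
                cartesianProductWith _∷ᵥ_ xs (allVecs k n)
    go []       = refl
    go (x ∷ xs) = cong (map (x ∷ᵥ_) (allVecs k n) ++_) (go xs)

  allVecs-unique : ∀ k n → Unique (allVecs k n)
  allVecs-unique k zero    = All.[] ∷ []
  allVecs-unique k (suc n) rewrite allVecs-suc k n =
    Unique.cartesianProductWith⁺ _∷ᵥ_ Vec.∷-injective (Unique.allFin⁺ k) (allVecs-unique k n)

  ∈-allVecs : ∀ {k n} (w : Vec (Fin k) n) → w ∈ allVecs k n
  ∈-allVecs []ᵥ = here refl
  ∈-allVecs {k} {suc n} (x ∷ᵥ w) rewrite allVecs-suc k n =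
    ∈-cartesianProductWith⁺ _∷ᵥ_ (∈-allFin x) (∈-allVecs w)

  module _ {n : ℕ} {P : Vec (Fin n) n → Set} (P? : Decidable P) where

    counted-unique : Unique (filter P? (Perms n))
    counted-unique = Unique.filter⁺ P? (Unique.filter⁺ isPerm? (allVecs-unique n n))

    ∈-counted⁺ : ∀ w → IsPerm w → P w → w ∈ filter P? (Perms n)
    ∈-counted⁺ w w-perm = ∈-filter⁺ P? (∈-filter⁺ isPerm? (∈-allVecs w) w-perm)

    ∈-counted⁻ : ∀ {w} → w ∈ filter P? (Perms n) → IsPerm w × P w
    ∈-counted⁻ w∈ with ∈-filter⁻ P? {xs = Perms n} w∈
    ... | w∈Perms , Pw = proj₂ (∈-filter⁻ isPerm? {xs = allVecs n n} w∈Perms) , Pw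

  module _ {m : ℕ} {P : Fin m → Set} (P? : Decidable P) {c : Fin m} where

    ∈-tabulate⁺ : P c → c ∈ₛ tabulate (⌊_⌋ ∘ P?)
    ∈-tabulate⁺ Pc =
      Vec.lookup⇒[]= c _ (trans (Vec.lookup∘tabulate _ c) (Equivalence.to T-≡ (fromWitness Pc)))

    ∈-tabulate⁻ : c ∈ₛ tabulate (⌊_⌋ ∘ P?) → P c
    ∈-tabulate⁻ c∈ =
      toWitness (Equivalence.from T-≡ (trans (sym (Vec.lookup∘tabulate _ c)) (Vec.[]=⇒lookup c∈)))

  Word : ℕ → Set
  Word m = Vec (Fin (suc m)) (suc m)

  isPerm⇒injective : ∀ {m} (w : Word m) → IsPerm w → Injective _≡_ _≡_ (lookup w)
  isPerm⇒injective w w-perm = w-perm _ _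

  module _ {m : ℕ} (w : Word m) where

    ∁⊆Con⇒connectedOutside : ∀ {S} → ∁ S ⊆ Con w → ConnectedOutside S (lookup w)
    ∁⊆Con⇒connectedOutside ∁S⊆C c c∉S = ∈-tabulate⁻ _ (∁S⊆C (x∉p⇒x∈∁p c∉S))

    connectedOutside⇒∁⊆Con : ∀ {S} → ConnectedOutside S (lookup w) → ∁ S ⊆ Con w
    connectedOutside⇒∁⊆Con connected c∈∁S = ∈-tabulate⁺ _ (connected _ (x∈∁p⇒x∉p c∈∁S))

    ⊆Des⇒descendsOn : ∀ {T} → T ⊆ Des w → DescendsOn T (lookup w)
    ⊆Des⇒descendsOn T⊆D c c∈T = ∈-tabulate⁻ _ (T⊆D c∈T)

    descendsOn⇒⊆Des : ∀ {T} → DescendsOn T (lookup w) → T ⊆ Des w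
    descendsOn⇒⊆Des descends c∈T = ∈-tabulate⁺ _ (descends _ c∈T)

  α? : ∀ {m} (S T : Subset m) → Decidable (λ (w : Word m) → ∁ S ⊆ Con w × T ⊆ Des w)
  α? S T w = (∁ S ⊆? Con w) ×-dec (T ⊆? Des w)

  α : (m : ℕ) → Subset m → Subset m → ℕ
  α m S T = countPerms (α? S T)

  compose : ∀ {m} → Word m × Word m → Word m
  compose (w , v) = mapᵥ (lookup w) v

  lookup-compose : ∀ {m} (w v : Word m) i → lookup (compose (w , v)) i ≡ lookup w (lookup v i)
  lookup-compose w v i = Vec.lookup-map i (lookup w) v

  lookup-injective : ∀ {m} {w w′ : Word m} → (∀ i → lookup w i ≡ lookup w′ i) → w ≡ w′
  lookup-injective {w = w} {w′} eq =
    trans (sym (Vec.tabulate∘lookup w)) (trans (Vec.tabulate-cong eq) (Vec.tabulate∘lookup w′))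

  module _ {m : ℕ} {S T : Subset m} (T⊆S : T ⊆ S) where

    private
      X Y Z : List (Word m)
      X = filter (α? S T) (Perms (suc m))
      Y = filter (α? T ⊥) (Perms (suc m))
      Z = filter (α? S ⊥) (Perms (suc m))

      left-factor : ∀ {w} → w ∈ X →
                    Injective _≡_ _≡_ (lookup w) × ConnectedOutside S (lookup w) × DescendsOn T (lookup w)
      left-factor {w} w∈X =
        let w-perm , ∁S⊆C , T⊆D = ∈-counted⁻ (α? S T) w∈X
        in isPerm⇒injective w w-perm , ∁⊆Con⇒connectedOutside w ∁S⊆C , ⊆Des⇒descendsOn w T⊆D

      right-factor : ∀ {v} → v ∈ Y → Injective _≡_ _≡_ (lookup v) × PreservesBlocks T (lookup v)
      right-factor {v} v∈Y =
        let v-perm , ∁T⊆C , _ = ∈-counted⁻ (α? T ⊥) v∈Y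
            v-inj = isPerm⇒injective v v-perm
        in v-inj , connectedOutside⇒preservesBlocks v-inj (∁⊆Con⇒connectedOutside v ∁T⊆C)

      compose-injectiveOn : ∀ {p q} → p ∈ cartesianProduct X Y → q ∈ cartesianProduct X Y →
                            compose p ≡ compose q → p ≡ q
      compose-injectiveOn {w , v} {w′ , v′} p∈ q∈ eq =
        let w∈X  , v∈Y  = ∈-cartesianProduct⁻ X Y p∈
            w′∈X , v′∈Y = ∈-cartesianProduct⁻ X Y q∈
            w-inj  , _ , w-desc  = left-factor w∈X
            w′-inj , _ , w′-desc = left-factor w′∈X
            v-inj  , v-blocks    = right-factor v∈Y
            v′-inj , v′-blocks   = right-factor v′∈Y
            w≗w′ = factorisation-unique w-inj w′-inj v-inj v′-inj v-blocks v′-blocks w-desc w′-desc agree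
        in cong₂ _,_ (lookup-injective w≗w′)
                     (lookup-injective λ i → w-inj (trans (agree i) (sym (w≗w′ (lookup v′ i)))))
        where
        agree : ∀ i → lookup w (lookup v i) ≡ lookup w′ (lookup v′ i)
        agree i = trans (sym (lookup-compose w v i))
                        (trans (cong (λ u → lookup u i) eq) (lookup-compose w′ v′ i))

      compose-into : ∀ {p} → p ∈ cartesianProduct X Y → compose p ∈ Z
      compose-into {w , v} p∈ =
        let w∈X , v∈Y = ∈-cartesianProduct⁻ X Y p∈
            w-inj , w-connected , _ = left-factor w∈X
            v-inj , v-blocks        = right-factor v∈Y
        in ∈-counted⁺ (α? S ⊥) (compose (w , v))
             (λ i j eq → v-inj (w-inj (trans (sym (lookup-compose w v i)) (trans eq (lookup-compose w v j)))))
             (connectedOutside⇒∁⊆Con (compose (w , v))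
                (connectedOutside-resp-≗ (sym ∘ lookup-compose w v)
                   (connectedOutside-∘ T⊆S w-connected v-blocks)) ,
              ⊥⊆)

      compose-onto : ∀ {u} → u ∈ Z → ∃ λ p → p ∈ cartesianProduct X Y × compose p ≡ u
      compose-onto {u} u∈Z =
        let u-perm , ∁S⊆C , _ = ∈-counted⁻ (α? S ⊥) u∈Z
            F , descends = factorise T⊆S (isPerm⇒injective u u-perm) (∁⊆Con⇒connectedOutside u ∁S⊆C)
        in factors F descends
        where
        factors : (F : Factorisation S T (lookup u)) → DescendsOn T (Factorisation.left F) →
                  ∃ λ p → p ∈ cartesianProduct X Y × compose p ≡ u
        factors F descends = (w , v) , ∈-cartesianProduct⁺ w∈X v∈Y , lookup-injective compose≗u
          where
          open Factorisation F
          w v : Word m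
          w = tabulate left
          v = tabulate right
          left≗w : ∀ i → left i ≡ lookup w i
          left≗w i = sym (Vec.lookup∘tabulate left i)
          right≗v : ∀ i → right i ≡ lookup v i
          right≗v i = sym (Vec.lookup∘tabulate right i)
          w∈X : w ∈ X
          w∈X = ∈-counted⁺ (α? S T) w (λ i j → injective-resp-≗ left≗w left-injective)
            (connectedOutside⇒∁⊆Con w (connectedOutside-resp-≗ left≗w left-connected) ,
             descendsOn⇒⊆Des w (descendsOn-resp-≗ left≗w descends))
          v∈Y : v ∈ Y
          v∈Y = ∈-counted⁺ (α? T ⊥) v (λ i j → injective-resp-≗ right≗v right-injective)
            (connectedOutside⇒∁⊆Con v
               (connectedOutside-resp-≗ right≗v (preservesBlocks⇒connectedOutside right-blocks)) , ⊥⊆)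
          compose≗u : ∀ i → lookup (compose (w , v)) i ≡ lookup u i
          compose≗u i = begin
            lookup (compose (w , v)) i ≡⟨ lookup-compose w v i ⟩
            lookup w (lookup v i)      ≡⟨ cong (lookup w) (right≗v i) ⟨
            lookup w (right i)         ≡⟨ left≗w (right i) ⟨
            left (right i)             ≡⟨ composes i ⟩
            lookup u i                 ∎
            where open ≡-Reasoning

    α-factorises : α m S ⊥ ≡ α m S T * α m T ⊥
    α-factorises = trans
      (sym (bijectiveOn⇒length≡ (Vec.≡-dec Fin._≟_) compose
        (Unique.cartesianProduct⁺ (counted-unique (α? S T)) (counted-unique (α? T ⊥)))
        (counted-unique (α? S ⊥))
        compose-injectiveOn compose-into compose-onto))
      (length-cartesianProduct X Y)

  connected-descent⇒⊆ : ∀ {m} {S T : Subset m} (w : Word m) → ∁ S ⊆ Con w → T ⊆ Des w → T ⊆ S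
  connected-descent⇒⊆ {S = S} w ∁S⊆C T⊆D {c} c∈T with c ∈? S
  ... | yes c∈S = c∈S
  ... | no c∉S  = contradiction (⊆Des⇒descendsOn w T⊆D c c∈T)
                    (splitsAt⇒¬descentAt (∁⊆Con⇒connectedOutside w ∁S⊆C c c∉S))

  module _ {m : ℕ} where

    α-vanishes : ∀ (S T : Subset m) → ¬ T ⊆ S → α m S T ≡ 0
    α-vanishes S T T⊈S = cong length (filter-none (α? S T)
      (All.universal (λ w (∁S⊆C , T⊆D) → T⊈S (connected-descent⇒⊆ w ∁S⊆C T⊆D)) (Perms (suc m))))

    α-⊥-positive : ∀ (T : Subset m) → 0 < α m T ⊥
    α-⊥-positive T = nonempty (∈-counted⁺ (α? T ⊥) identity identity-perm (∁T⊆Con , ⊥⊆))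
      where
      identity : Word m
      identity = tabulate id
      id≗identity : ∀ i → i ≡ lookup identity i
      id≗identity i = sym (Vec.lookup∘tabulate id i)
      identity-perm : IsPerm identity
      identity-perm i j = injective-resp-≗ id≗identity id
      ∁T⊆Con : ∁ T ⊆ Con identity
      ∁T⊆Con = connectedOutside⇒∁⊆Con identity (connectedOutside-resp-≗ id≗identity (λ c _ → id-splitsAt c))
      nonempty : ∀ {A : Set} {x : A} {xs} → x ∈ xs → 0 < length xs
      nonempty (here _)  = s≤s z≤n
      nonempty (there _) = s≤s z≤n

    α-diagonal : ∀ (S : Subset m) → α m S S ≡ 1
    α-diagonal S = *-cancelʳ-≡ (α m S S) 1 (α m S ⊥) {{>-nonZero (α-⊥-positive S)}}
      (trans (sym (α-factorises {S = S} {T = S} id)) (sym (*-identityˡ (α m S ⊥))))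

    α-multiplicative : ∀ (S U T : Subset m) → T ⊆ U → U ⊆ S → α m S U * α m U T ≡ α m S T
    α-multiplicative S U T T⊆U U⊆S = *-cancelʳ-≡ _ _ (α m T ⊥) {{>-nonZero (α-⊥-positive T)}} (begin
      α m S U * α m U T * α m T ⊥    ≡⟨ *-assoc (α m S U) _ _ ⟩
      α m S U * (α m U T * α m T ⊥)  ≡⟨ cong (α m S U *_) (α-factorises {S = U} {T = T} T⊆U) ⟨
      α m S U * α m U ⊥              ≡⟨ α-factorises {S = S} {T = U} U⊆S ⟨
      α m S ⊥                        ≡⟨ α-factorises {S = S} {T = T} (U⊆S ∘ T⊆U) ⟩
      α m S T * α m T ⊥              ∎)
      where open ≡-Reasoning


module SubsetMatrices where

  open import Algebra.Bundles using (Monoid)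
  open import Level using (0ℓ)
  open import Data.Bool using (Bool; true; false; if_then_else_)
  open import Data.Nat using (ℕ; zero; suc)
  open import Data.Integer using (ℤ; +_; -_; _+_; _*_)
  open import Data.Integer.Properties
  open import Data.Integer.Solver using (module +-*-Solver)
  open import Data.Fin.Subset using (Subset; ∣_∣)
  open import Data.Fin.Subset.Properties using (_⊆?_)
  open import Data.Vec using () renaming ([] to []ᵥ; _∷_ to _∷ᵥ_)
  open import Data.List using (List; []; _∷_; _++_; map; filter; length)
  open import Data.Product using (_,_)
  open import Relation.Nullary using (Dec; does; yes; no; ¬_; contradiction)
  open import Relation.Nullary.Decidable using (_×-dec_; isYes≗does)
  open import Relation.Unary using (Decidable)
  open import Relation.Binary.PropositionalEquality
  import Relation.Binary.Reasoning.Setoid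
  open import Function using (_∘_)

  open +-*-Solver using (solve; _:+_; _:*_; :-_; _:=_; con)

  -- Defined via does rather than ⌊_⌋ (as Id is), so that it computes on decisions about
  -- subsets whose first elements are known.
  ⟦_⟧ : {P : Set} → Dec P → ℤ
  ⟦ d ⟧ = if does d then + 1 else + 0

  module _ {P : Set} where

    ⟦⟧-yes : (d : Dec P) → P → ⟦ d ⟧ ≡ + 1
    ⟦⟧-yes (yes _) _  = refl
    ⟦⟧-yes (no ¬p) p  = contradiction p ¬p

    ⟦⟧-no : (d : Dec P) → ¬ P → ⟦ d ⟧ ≡ + 0
    ⟦⟧-no (yes p) ¬p = contradiction p ¬p
    ⟦⟧-no (no _)  _  = refl

  module _ {P Q : Set} where

    ⟦⟧-cong : (P → Q) → (Q → P) → (d : Dec P) (e : Dec Q) → ⟦ d ⟧ ≡ ⟦ e ⟧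
    ⟦⟧-cong P→Q _   (yes p) e = sym (⟦⟧-yes e (P→Q p))
    ⟦⟧-cong _   Q→P (no ¬p) e = sym (⟦⟧-no e (¬p ∘ Q→P))

    ⟦⟧-× : (d : Dec P) (e : Dec Q) → ⟦ d ×-dec e ⟧ ≡ ⟦ d ⟧ * ⟦ e ⟧
    ⟦⟧-× (yes _) (yes _) = refl
    ⟦⟧-× (yes _) (no _)  = refl
    ⟦⟧-× (no _)  _       = refl

  ∑ : {A : Set} → List A → (A → ℤ) → ℤ
  ∑ xs f = sumℤ (map f xs)

  infix 5 ∑
  syntax ∑ xs (λ x → e) = ∑[ x ∈ xs ] e

  module _ {A : Set} where

    ∑-cong : (xs : List A) {f g : A → ℤ} → (∀ x → f x ≡ g x) → ∑ xs f ≡ ∑ xs g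
    ∑-cong []       _   = refl
    ∑-cong (x ∷ xs) f≗g = cong₂ _+_ (f≗g x) (∑-cong xs f≗g)

    ∑-zero : (xs : List A) → ∑[ x ∈ xs ] + 0 ≡ + 0
    ∑-zero []       = refl
    ∑-zero (x ∷ xs) = trans (+-identityˡ _) (∑-zero xs)

    ∑-vanishes : (xs : List A) {f : A → ℤ} → (∀ x → f x ≡ + 0) → ∑ xs f ≡ + 0
    ∑-vanishes xs f≗0 = trans (∑-cong xs f≗0) (∑-zero xs)

    ∑-distrib-+ : (xs : List A) (f g : A → ℤ) → ∑[ x ∈ xs ] (f x + g x) ≡ ∑ xs f + ∑ xs g
    ∑-distrib-+ []       f g = refl
    ∑-distrib-+ (x ∷ xs) f g = trans (cong (_+_ (f x + g x)) (∑-distrib-+ xs f g))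
      (solve 4 (λ a b c d → (a :+ b) :+ (c :+ d) := (a :+ c) :+ (b :+ d)) refl (f x) (g x) (∑ xs f) (∑ xs g))

    ∑-*ˡ : (xs : List A) (c : ℤ) (f : A → ℤ) → c * ∑ xs f ≡ ∑[ x ∈ xs ] (c * f x)
    ∑-*ˡ []       c f = *-zeroʳ c
    ∑-*ˡ (x ∷ xs) c f = trans (*-distribˡ-+ c (f x) _) (cong (_+_ (c * f x)) (∑-*ˡ xs c f))

    ∑-neg : (xs : List A) (f : A → ℤ) → ∑[ x ∈ xs ] - f x ≡ - ∑ xs f
    ∑-neg xs f = begin
      ∑[ x ∈ xs ] - f x          ≡⟨ ∑-cong xs (λ x → -1*i≡-i (f x)) ⟨
      ∑[ x ∈ xs ] - + 1 * f x    ≡⟨ ∑-*ˡ xs (- + 1) f ⟨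
      - + 1 * ∑ xs f             ≡⟨ -1*i≡-i (∑ xs f) ⟩
      - ∑ xs f                   ∎
      where open ≡-Reasoning

    ∑-*ʳ : (xs : List A) (c : ℤ) (f : A → ℤ) → ∑ xs f * c ≡ ∑[ x ∈ xs ] (f x * c)
    ∑-*ʳ xs c f = trans (*-comm (∑ xs f) c) (trans (∑-*ˡ xs c f) (∑-cong xs (λ x → *-comm c (f x))))

    ∑-++ : (xs ys : List A) (f : A → ℤ) → ∑ (xs ++ ys) f ≡ ∑ xs f + ∑ ys f
    ∑-++ []       ys f = sym (+-identityˡ _)
    ∑-++ (x ∷ xs) ys f = trans (cong (_+_ (f x)) (∑-++ xs ys f)) (sym (+-assoc (f x) _ _))

    ∑-map : {B : Set} (g : B → A) (xs : List B) (f : A → ℤ) → ∑ (map g xs) f ≡ ∑ xs (f ∘ g)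
    ∑-map g []       f = refl
    ∑-map g (x ∷ xs) f = cong (_+_ (f (g x))) (∑-map g xs f)

    length-filter : {P : A → Set} (P? : Decidable P) (xs : List A) →
                    + length (filter P? xs) ≡ ∑[ x ∈ xs ] ⟦ P? x ⟧
    length-filter P? []       = refl
    length-filter P? (x ∷ xs) with P? x
    ... | yes _ = trans (pos-+ 1 _) (cong (_+_ (+ 1)) (length-filter P? xs))
    ... | no _  = trans (length-filter P? xs) (sym (+-identityˡ _))

  ∑-comm : {A B : Set} (xs : List A) (ys : List B) (f : A → B → ℤ) →
           ∑[ x ∈ xs ] ∑[ y ∈ ys ] f x y ≡ ∑[ y ∈ ys ] ∑[ x ∈ xs ] f x y
  ∑-comm []       ys f = sym (∑-zero ys)
  ∑-comm (x ∷ xs) ys f = trans (cong (_+_ (∑ ys (f x))) (∑-comm xs ys f)) (sym (∑-distrib-+ ys (f x) _))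

  ∑-subsets-suc : ∀ {m} (f : Subset (suc m) → ℤ) →
                  ∑ (allSubsets (suc m)) f ≡ ∑ (allSubsets m) (f ∘ (true ∷ᵥ_)) + ∑ (allSubsets m) (f ∘ (false ∷ᵥ_))
  ∑-subsets-suc {m} f = begin
    ∑ (ins true ++ ins false ++ []) f
      ≡⟨ ∑-++ (ins true) _ f ⟩
    ∑ (ins true) f + ∑ (ins false ++ []) f
      ≡⟨ cong (_+_ (∑ (ins true) f)) (trans (∑-++ (ins false) [] f) (+-identityʳ _)) ⟩
    ∑ (ins true) f + ∑ (ins false) f
      ≡⟨ cong₂ _+_ (∑-map (true ∷ᵥ_) (allSubsets m) f) (∑-map (false ∷ᵥ_) (allSubsets m) f) ⟩
    ∑ (allSubsets m) (f ∘ (true ∷ᵥ_)) + ∑ (allSubsets m) (f ∘ (false ∷ᵥ_)) ∎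
    where
    open ≡-Reasoning
    ins : Bool → List (Subset (suc m))
    ins b = map (b ∷ᵥ_) (allSubsets m)

  ∑-subsets-δ : ∀ {m} (a : Subset m) (f : Subset m → ℤ) → ∑[ U ∈ allSubsets m ] ⟦ a ≟ₛ U ⟧ * f U ≡ f a
  ∑-subsets-δ []ᵥ f = trans (+-identityʳ _) (*-identityˡ (f []ᵥ))
  ∑-subsets-δ {suc m} (true ∷ᵥ a) f = begin
    ∑[ U ∈ allSubsets (suc m) ] ⟦ (true ∷ᵥ a) ≟ₛ U ⟧ * f U
      ≡⟨ ∑-subsets-suc {m} (λ U → ⟦ (true ∷ᵥ a) ≟ₛ U ⟧ * f U) ⟩
    (∑[ U ∈ allSubsets m ] ⟦ a ≟ₛ U ⟧ * f (true ∷ᵥ U)) + (∑[ U ∈ allSubsets m ] + 0)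
      ≡⟨ cong₂ _+_ (∑-subsets-δ a (f ∘ (true ∷ᵥ_))) (∑-zero (allSubsets m)) ⟩
    f (true ∷ᵥ a) + + 0
      ≡⟨ +-identityʳ _ ⟩
    f (true ∷ᵥ a) ∎
    where open ≡-Reasoning
  ∑-subsets-δ {suc m} (false ∷ᵥ a) f = begin
    ∑[ U ∈ allSubsets (suc m) ] ⟦ (false ∷ᵥ a) ≟ₛ U ⟧ * f U
      ≡⟨ ∑-subsets-suc {m} (λ U → ⟦ (false ∷ᵥ a) ≟ₛ U ⟧ * f U) ⟩
    (∑[ U ∈ allSubsets m ] + 0) + (∑[ U ∈ allSubsets m ] ⟦ a ≟ₛ U ⟧ * f (false ∷ᵥ U))
      ≡⟨ cong₂ _+_ (∑-zero (allSubsets m)) (∑-subsets-δ a (f ∘ (false ∷ᵥ_))) ⟩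
    + 0 + f (false ∷ᵥ a)
      ≡⟨ +-identityˡ _ ⟩
    f (false ∷ᵥ a) ∎
    where open ≡-Reasoning

  module _ {m : ℕ} where

    infix 4 _≈_
    _≈_ : Mat m → Mat m → Set
    M ≈ N = ∀ S T → M S T ≡ N S T

    ≈-refl : ∀ {M} → M ≈ M
    ≈-refl S T = refl

    ≈-sym : ∀ {M N} → M ≈ N → N ≈ M
    ≈-sym M≈N S T = sym (M≈N S T)

    ≈-trans : ∀ {M N P} → M ≈ N → N ≈ P → M ≈ P
    ≈-trans M≈N N≈P S T = trans (M≈N S T) (N≈P S T)

    Id≡⟦≟⟧ : ∀ (S T : Subset m) → Id S T ≡ ⟦ S ≟ₛ T ⟧
    Id≡⟦≟⟧ S T = cong (λ b → if b then + 1 else + 0) (isYes≗does (S ≟ₛ T))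

    ⟦≟⟧-sym : ∀ (S T : Subset m) → ⟦ S ≟ₛ T ⟧ ≡ ⟦ T ≟ₛ S ⟧
    ⟦≟⟧-sym S T = ⟦⟧-cong sym sym (S ≟ₛ T) (T ≟ₛ S)

    ⊗-cong : ∀ {M M′ N N′ : Mat m} → M ≈ M′ → N ≈ N′ → M ⊗ N ≈ M′ ⊗ N′
    ⊗-cong M≈M′ N≈N′ S T = ∑-cong (allSubsets m) (λ U → cong₂ _*_ (M≈M′ S U) (N≈N′ U T))

    ⊗-assoc : ∀ (M N P : Mat m) → (M ⊗ N) ⊗ P ≈ M ⊗ (N ⊗ P)
    ⊗-assoc M N P S T = begin
      ∑[ V ∈ allSubsets m ] (∑[ U ∈ allSubsets m ] M S U * N U V) * P V T
        ≡⟨ ∑-cong (allSubsets m) (λ V → ∑-*ʳ (allSubsets m) (P V T) _) ⟩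
      ∑[ V ∈ allSubsets m ] ∑[ U ∈ allSubsets m ] M S U * N U V * P V T
        ≡⟨ ∑-comm (allSubsets m) (allSubsets m) _ ⟩
      ∑[ U ∈ allSubsets m ] ∑[ V ∈ allSubsets m ] M S U * N U V * P V T
        ≡⟨ ∑-cong (allSubsets m) (λ U → ∑-cong (allSubsets m) (λ V → *-assoc (M S U) _ _)) ⟩
      ∑[ U ∈ allSubsets m ] ∑[ V ∈ allSubsets m ] M S U * (N U V * P V T)
        ≡⟨ ∑-cong (allSubsets m) (λ U → ∑-*ˡ (allSubsets m) (M S U) _) ⟨
      ∑[ U ∈ allSubsets m ] M S U * (∑[ V ∈ allSubsets m ] N U V * P V T) ∎
      where open ≡-Reasoning

    ⊗-identityˡ : ∀ (M : Mat m) → Id ⊗ M ≈ M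
    ⊗-identityˡ M S T =
      trans (∑-cong (allSubsets m) (λ U → cong (_* M U T) (Id≡⟦≟⟧ S U))) (∑-subsets-δ S (λ U → M U T))

    ⊗-identityʳ : ∀ (M : Mat m) → M ⊗ Id ≈ M
    ⊗-identityʳ M S T = trans (∑-cong (allSubsets m) flip) (∑-subsets-δ T (M S))
      where
      flip : ∀ U → M S U * Id U T ≡ ⟦ T ≟ₛ U ⟧ * M S U
      flip U = trans (*-comm (M S U) _) (cong (_* M S U) (trans (Id≡⟦≟⟧ U T) (⟦≟⟧-sym U T)))

    Mat-monoid : Monoid 0ℓ 0ℓ
    Mat-monoid = record
      { Carrier  = Mat m
      ; _≈_      = _≈_
      ; _∙_      = _⊗_
      ; ε        = Id
      ; isMonoid = record
        { isSemigroup = record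
          { isMagma = record
            { isEquivalence = record { refl = ≈-refl ; sym = ≈-sym ; trans = ≈-trans }
            ; ∙-cong = ⊗-cong
            }
          ; assoc = ⊗-assoc
          }
        ; identity = ⊗-identityˡ , ⊗-identityʳ
        }
      }

    module ≈-Reasoning = Relation.Binary.Reasoning.Setoid (Monoid.setoid Mat-monoid)

  negOnePow-+ : ∀ a b → negOnePow (a Data.Nat.+ b) ≡ negOnePow a * negOnePow b
  negOnePow-+ zero    b = sym (*-identityˡ _)
  negOnePow-+ (suc a) b = trans (cong -_ (negOnePow-+ a b)) (neg-distribˡ-* (negOnePow a) (negOnePow b))

  negOnePow-square : ∀ k → negOnePow k * negOnePow k ≡ + 1
  negOnePow-square zero    = refl
  negOnePow-square (suc k) =
    trans (solve 1 (λ a → (:- a) :* (:- a) := a :* a) refl (negOnePow k)) (negOnePow-square k)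

  sg : ∀ {m} → Subset m → ℤ
  sg S = negOnePow ∣ S ∣

  Sgn : ∀ {m} → Mat m
  Sgn S T = ⟦ S ≟ₛ T ⟧ * sg S

  ζ : ∀ {m} → Mat m
  ζ S U = ⟦ U ⊆? S ⟧

  -- Splitting U by its first coordinate, the entries of ζ, sg and ⟦_≟ₛ_⟧ at b ∷ U reduce to
  -- those at U, except that sg flips sign when b = true.
  möbius : ∀ {m} (S T : Subset m) → ∑[ U ∈ allSubsets m ] ζ S U * (sg U * ζ U T) ≡ Sgn S T
  möbius []ᵥ []ᵥ = refl
  möbius {suc m} (true ∷ᵥ S) (true ∷ᵥ T) = begin
    ∑[ U ∈ allSubsets (suc m) ] ζ (true ∷ᵥ S) U * (sg U * ζ U (true ∷ᵥ T))
      ≡⟨ ∑-subsets-suc (λ U → ζ (true ∷ᵥ S) U * (sg U * ζ U (true ∷ᵥ T))) ⟩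
    (∑[ U ∈ allSubsets m ] ζ S U * (- sg U * ζ U T)) + (∑[ U ∈ allSubsets m ] ζ S U * (sg U * + 0))
      ≡⟨ cong₂ _+_ (∑-cong (allSubsets m) (λ U → neg-middle (ζ S U) (sg U) (ζ U T)))
                   (∑-vanishes (allSubsets m) (λ U → zero-right (ζ S U) (sg U))) ⟩
    (∑[ U ∈ allSubsets m ] - (ζ S U * (sg U * ζ U T))) + + 0
      ≡⟨ trans (+-identityʳ _) (∑-neg (allSubsets m) _) ⟩
    - (∑[ U ∈ allSubsets m ] ζ S U * (sg U * ζ U T))
      ≡⟨ cong -_ (möbius S T) ⟩
    - (⟦ S ≟ₛ T ⟧ * sg S)
      ≡⟨ neg-distribʳ-* ⟦ S ≟ₛ T ⟧ (sg S) ⟩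
    ⟦ S ≟ₛ T ⟧ * - sg S ∎
    where
    open ≡-Reasoning
    neg-middle : ∀ a b c → a * (- b * c) ≡ - (a * (b * c))
    neg-middle = solve 3 (λ a b c → a :* (:- b :* c) := :- (a :* (b :* c))) refl
    zero-right : ∀ a b → a * (b * + 0) ≡ + 0
    zero-right = solve 2 (λ a b → a :* (b :* con (+ 0)) := con (+ 0)) refl
  möbius {suc m} (true ∷ᵥ S) (false ∷ᵥ T) = begin
    ∑[ U ∈ allSubsets (suc m) ] ζ (true ∷ᵥ S) U * (sg U * ζ U (false ∷ᵥ T))
      ≡⟨ ∑-subsets-suc (λ U → ζ (true ∷ᵥ S) U * (sg U * ζ U (false ∷ᵥ T))) ⟩
    (∑[ U ∈ allSubsets m ] ζ S U * (- sg U * ζ U T)) + (∑[ U ∈ allSubsets m ] ζ S U * (sg U * ζ U T))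
      ≡⟨ ∑-distrib-+ (allSubsets m) _ _ ⟨
    ∑[ U ∈ allSubsets m ] (ζ S U * (- sg U * ζ U T) + ζ S U * (sg U * ζ U T))
      ≡⟨ ∑-vanishes (allSubsets m) (λ U → cancel (ζ S U) (sg U) (ζ U T)) ⟩
    + 0 ∎
    where
    open ≡-Reasoning
    cancel : ∀ a b c → a * (- b * c) + a * (b * c) ≡ + 0
    cancel = solve 3 (λ a b c → a :* (:- b :* c) :+ a :* (b :* c) := con (+ 0)) refl
  möbius {suc m} (false ∷ᵥ S) (true ∷ᵥ T) = begin
    ∑[ U ∈ allSubsets (suc m) ] ζ (false ∷ᵥ S) U * (sg U * ζ U (true ∷ᵥ T))
      ≡⟨ ∑-subsets-suc (λ U → ζ (false ∷ᵥ S) U * (sg U * ζ U (true ∷ᵥ T))) ⟩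
    (∑[ U ∈ allSubsets m ] + 0) + (∑[ U ∈ allSubsets m ] ζ S U * (sg U * + 0))
      ≡⟨ cong₂ _+_ (∑-zero (allSubsets m)) (∑-vanishes (allSubsets m) (λ U → zero-right (ζ S U) (sg U))) ⟩
    + 0 ∎
    where
    open ≡-Reasoning
    zero-right : ∀ a b → a * (b * + 0) ≡ + 0
    zero-right = solve 2 (λ a b → a :* (b :* con (+ 0)) := con (+ 0)) refl
  möbius {suc m} (false ∷ᵥ S) (false ∷ᵥ T) = begin
    ∑[ U ∈ allSubsets (suc m) ] ζ (false ∷ᵥ S) U * (sg U * ζ U (false ∷ᵥ T))
      ≡⟨ ∑-subsets-suc (λ U → ζ (false ∷ᵥ S) U * (sg U * ζ U (false ∷ᵥ T))) ⟩
    (∑[ U ∈ allSubsets m ] + 0) + (∑[ U ∈ allSubsets m ] ζ S U * (sg U * ζ U T))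
      ≡⟨ cong₂ _+_ (∑-zero (allSubsets m)) (möbius S T) ⟩
    + 0 + ⟦ S ≟ₛ T ⟧ * sg S
      ≡⟨ +-identityˡ _ ⟩
    ⟦ S ≟ₛ T ⟧ * sg S ∎
    where open ≡-Reasoning

  module _ {m : ℕ} where

    Sgn-⊗ : ∀ (M : Mat m) S T → (Sgn ⊗ M) S T ≡ sg S * M S T
    Sgn-⊗ M S T = trans (∑-cong (allSubsets m) (λ U → *-assoc ⟦ S ≟ₛ U ⟧ (sg S) (M U T)))
                        (∑-subsets-δ S (λ U → sg S * M U T))

    ⊗-Sgn : ∀ (M : Mat m) S T → (M ⊗ Sgn) S T ≡ M S T * sg T
    ⊗-Sgn M S T = trans (∑-cong (allSubsets m) reorder) (∑-subsets-δ T (λ U → M S U * sg U))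
      where
      reorder : ∀ U → M S U * (⟦ U ≟ₛ T ⟧ * sg U) ≡ ⟦ T ≟ₛ U ⟧ * (M S U * sg U)
      reorder U = trans (cong (λ d → M S U * (d * sg U)) (⟦≟⟧-sym U T))
                        (solve 3 (λ a d s → a :* (d :* s) := d :* (a :* s)) refl (M S U) ⟦ T ≟ₛ U ⟧ (sg U))

    Sgn⊗Sgn≈Id : Sgn ⊗ Sgn ≈ Id {m}
    Sgn⊗Sgn≈Id S T = begin
      (Sgn ⊗ Sgn) S T
        ≡⟨ Sgn-⊗ Sgn S T ⟩
      sg S * (⟦ S ≟ₛ T ⟧ * sg S)
        ≡⟨ solve 2 (λ s d → s :* (d :* s) := d :* (s :* s)) refl (sg S) ⟦ S ≟ₛ T ⟧ ⟩
      ⟦ S ≟ₛ T ⟧ * (sg S * sg S)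
        ≡⟨ cong (⟦ S ≟ₛ T ⟧ *_) (negOnePow-square ∣ S ∣) ⟩
      ⟦ S ≟ₛ T ⟧ * + 1
        ≡⟨ *-identityʳ _ ⟩
      ⟦ S ≟ₛ T ⟧
        ≡⟨ Id≡⟦≟⟧ S T ⟨
      Id S T ∎
      where open ≡-Reasoning

    sgn-twist : ∀ (M : Mat m) → (λ S T → sgn S T * M S T) ≈ Sgn ⊗ (M ⊗ Sgn)
    sgn-twist M S T = begin
      sgn S T * M S T
        ≡⟨ cong (_* M S T) (negOnePow-+ ∣ S ∣ ∣ T ∣) ⟩
      sg S * sg T * M S T
        ≡⟨ solve 3 (λ s t a → s :* t :* a := s :* (a :* t)) refl (sg S) (sg T) (M S T) ⟩
      sg S * (M S T * sg T)
        ≡⟨ cong (sg S *_) (⊗-Sgn M S T) ⟨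
      sg S * (M ⊗ Sgn) S T
        ≡⟨ Sgn-⊗ (M ⊗ Sgn) S T ⟨
      (Sgn ⊗ (M ⊗ Sgn)) S T ∎
      where open ≡-Reasoning

    Sgn-*-diagonal : ∀ (M : Mat m) → (∀ S → M S S ≡ + 1) → ∀ S T → Sgn S T * M S T ≡ Sgn S T
    Sgn-*-diagonal M diagonal S T with S ≟ₛ T
    ... | yes refl = trans (cong (+ 1 * sg S *_) (diagonal S)) (*-identityʳ (+ 1 * sg S))
    ... | no _     = refl

    ζ⊗Sgn⊗ζ≈Sgn : ζ ⊗ (Sgn ⊗ ζ) ≈ Sgn {m}
    ζ⊗Sgn⊗ζ≈Sgn S T = trans (∑-cong (allSubsets m) (λ U → cong (ζ S U *_) (Sgn-⊗ ζ U T))) (möbius S T)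


module TwistedInverses where

  open import Algebra.Bundles using (Monoid)
  open import Data.Product using (_×_; _,_)

  module _ {c ℓ} (𝕄 : Monoid c ℓ) where

    open Monoid 𝕄
    open import Relation.Binary.Reasoning.Setoid setoid
    open import Algebra.Solver.Monoid 𝕄 using (solve; _⊜_; _⊕_)

    cancel-invertible : ∀ {Z W X Y} → Z ∙ W ≈ ε → W ∙ Z ≈ ε → Z ∙ (X ∙ Z) ≈ Z ∙ (Y ∙ Z) → X ≈ Y
    cancel-invertible {Z} {W} {X} {Y} ZW≈ε WZ≈ε ZXZ≈ZYZ = begin
      X
        ≈⟨ identityˡ X ⟨
      ε ∙ X
        ≈⟨ ∙-cong (sym WZ≈ε) (sym (identityʳ X)) ⟩
      (W ∙ Z) ∙ (X ∙ ε)
        ≈⟨ ∙-congˡ (∙-congˡ (sym ZW≈ε)) ⟩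
      (W ∙ Z) ∙ (X ∙ (Z ∙ W))
        ≈⟨ solve 3 (λ w z x → (w ⊕ z) ⊕ (x ⊕ (z ⊕ w)) ⊜ w ⊕ ((z ⊕ (x ⊕ z)) ⊕ w)) refl W Z X ⟩
      W ∙ ((Z ∙ (X ∙ Z)) ∙ W)
        ≈⟨ ∙-congˡ (∙-congʳ ZXZ≈ZYZ) ⟩
      W ∙ ((Z ∙ (Y ∙ Z)) ∙ W)
        ≈⟨ solve 3 (λ w z y → w ⊕ ((z ⊕ (y ⊕ z)) ⊕ w) ⊜ (w ⊕ z) ⊕ (y ⊕ (z ⊕ w))) refl W Z Y ⟩
      (W ∙ Z) ∙ (Y ∙ (Z ∙ W))
        ≈⟨ ∙-cong WZ≈ε (∙-congˡ ZW≈ε) ⟩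
      ε ∙ (Y ∙ ε)
        ≈⟨ trans (identityˡ _) (identityʳ Y) ⟩
      Y ∎

    module _ {E : Carrier} (E∙E≈ε : E ∙ E ≈ ε) where

      twisted-inverse : ∀ {X Y} → X ∙ (E ∙ Y) ≈ E → Y ∙ (E ∙ X) ≈ E →
                        X ∙ (E ∙ (Y ∙ E)) ≈ ε × (E ∙ (Y ∙ E)) ∙ X ≈ ε
      twisted-inverse {X} {Y} XEY≈E YEX≈E =
        (begin
          X ∙ (E ∙ (Y ∙ E))    ≈⟨ solve 3 (λ x e y → x ⊕ (e ⊕ (y ⊕ e)) ⊜ (x ⊕ (e ⊕ y)) ⊕ e) refl X E Y ⟩
          (X ∙ (E ∙ Y)) ∙ E    ≈⟨ ∙-congʳ XEY≈E ⟩
          E ∙ E                ≈⟨ E∙E≈ε ⟩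
          ε                    ∎) ,
        (begin
          (E ∙ (Y ∙ E)) ∙ X    ≈⟨ solve 3 (λ x e y → (e ⊕ (y ⊕ e)) ⊕ x ⊜ e ⊕ (y ⊕ (e ⊕ x))) refl X E Y ⟩
          E ∙ (Y ∙ (E ∙ X))    ≈⟨ ∙-congˡ YEX≈E ⟩
          E ∙ E                ≈⟨ E∙E≈ε ⟩
          ε                    ∎)

      module _ {Z : Carrier} (ZEZ≈E : Z ∙ (E ∙ Z) ≈ E) where

        twisted-conjugate : ∀ {X Y} → X ≈ Z ∙ (Y ∙ Z) → X ∙ (E ∙ X) ≈ E → Y ∙ (E ∙ Y) ≈ E
        twisted-conjugate {X} {Y} X≈ZYZ XEX≈E = cancel-invertible ZW≈ε WZ≈ε (begin
          Z ∙ ((Y ∙ (E ∙ Y)) ∙ Z)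
            ≈⟨ solve 3 (λ z y e → z ⊕ ((y ⊕ (e ⊕ y)) ⊕ z) ⊜ (z ⊕ y) ⊕ (e ⊕ (y ⊕ z))) refl Z Y E ⟩
          (Z ∙ Y) ∙ (E ∙ (Y ∙ Z))
            ≈⟨ ∙-congˡ (∙-congʳ (sym ZEZ≈E)) ⟩
          (Z ∙ Y) ∙ ((Z ∙ (E ∙ Z)) ∙ (Y ∙ Z))
            ≈⟨ solve 3 (λ z y e → (z ⊕ y) ⊕ ((z ⊕ (e ⊕ z)) ⊕ (y ⊕ z)) ⊜ (z ⊕ (y ⊕ z)) ⊕ (e ⊕ (z ⊕ (y ⊕ z)))) refl Z Y E ⟩
          (Z ∙ (Y ∙ Z)) ∙ (E ∙ (Z ∙ (Y ∙ Z)))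
            ≈⟨ ∙-cong (sym X≈ZYZ) (∙-congˡ (sym X≈ZYZ)) ⟩
          X ∙ (E ∙ X)
            ≈⟨ XEX≈E ⟩
          E
            ≈⟨ ZEZ≈E ⟨
          Z ∙ (E ∙ Z) ∎)
          where
          W : Carrier
          W = E ∙ (Z ∙ E)
          ZW≈ε : Z ∙ W ≈ ε
          ZW≈ε = begin
            Z ∙ (E ∙ (Z ∙ E))   ≈⟨ solve 2 (λ z e → z ⊕ (e ⊕ (z ⊕ e)) ⊜ (z ⊕ (e ⊕ z)) ⊕ e) refl Z E ⟩
            (Z ∙ (E ∙ Z)) ∙ E   ≈⟨ ∙-congʳ ZEZ≈E ⟩
            E ∙ E               ≈⟨ E∙E≈ε ⟩
            ε                   ∎
          WZ≈ε : W ∙ Z ≈ ε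
          WZ≈ε = begin
            (E ∙ (Z ∙ E)) ∙ Z   ≈⟨ solve 2 (λ z e → (e ⊕ (z ⊕ e)) ⊕ z ⊜ e ⊕ (z ⊕ (e ⊕ z))) refl Z E ⟩
            E ∙ (Z ∙ (E ∙ Z))   ≈⟨ ∙-congˡ ZEZ≈E ⟩
            E ∙ E               ≈⟨ E∙E≈ε ⟩
            ε                   ∎

        twisted-factors : ∀ {Y} → Y ∙ (E ∙ Y) ≈ E →
                          (Z ∙ Y) ∙ (E ∙ (Y ∙ Z)) ≈ E × (Y ∙ Z) ∙ (E ∙ (Z ∙ Y)) ≈ E
        twisted-factors {Y} YEY≈E =
          (begin
            (Z ∙ Y) ∙ (E ∙ (Y ∙ Z))
              ≈⟨ solve 3 (λ z y e → (z ⊕ y) ⊕ (e ⊕ (y ⊕ z)) ⊜ z ⊕ ((y ⊕ (e ⊕ y)) ⊕ z)) refl Z Y E ⟩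
            Z ∙ ((Y ∙ (E ∙ Y)) ∙ Z)
              ≈⟨ ∙-congˡ (∙-congʳ YEY≈E) ⟩
            Z ∙ (E ∙ Z)
              ≈⟨ ZEZ≈E ⟩
            E ∎) ,
          (begin
            (Y ∙ Z) ∙ (E ∙ (Z ∙ Y))
              ≈⟨ solve 3 (λ z y e → (y ⊕ z) ⊕ (e ⊕ (z ⊕ y)) ⊜ y ⊕ ((z ⊕ (e ⊕ z)) ⊕ y)) refl Z Y E ⟩
            Y ∙ ((Z ∙ (E ∙ Z)) ∙ Y)
              ≈⟨ ∙-congˡ (∙-congʳ ZEZ≈E) ⟩
            Y ∙ (E ∙ Y)
              ≈⟨ YEY≈E ⟩
            E ∎)


module StatisticMatrices where

  open Counting using (α; α-vanishes; α-diagonal; α-multiplicative)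
  open SubsetMatrices
  open TwistedInverses
  open import Data.Nat using (ℕ; suc)
  import Data.Nat as ℕ
  open import Data.Integer using (+_; _*_)
  open import Data.Integer.Properties
  open import Data.Integer.Solver using (module +-*-Solver)
  open import Data.Bool.Properties using (not-involutive)
  open import Data.Fin using (Fin)
  open import Data.Fin.Subset using (Subset; _⊆_; ∁)
  open import Data.Fin.Subset.Properties using (_⊆?_; x∈∁p⇒x∉p; x∉∁p⇒x∈p)
  open import Data.Vec using (Vec) renaming ([] to []ᵥ; _∷_ to _∷ᵥ_)
  open import Data.Product using (_,_; proj₁; proj₂)
  open import Function using (_∘_)
  open import Relation.Nullary using (yes; no)
  open import Relation.Nullary.Decidable using (_×-dec_)
  open import Relation.Unary using (Decidable)
  open import Relation.Binary.PropositionalEquality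

  open +-*-Solver using (solve; _:*_; _:=_)

  ⟦⟧-count : ∀ {n} {P Q : Vec (Fin n) n → Set} (P? : Decidable P) (Q? : Decidable Q) →
             + countPerms (λ w → P? w ×-dec Q? w) ≡ ∑[ w ∈ Perms n ] ⟦ P? w ⟧ * ⟦ Q? w ⟧
  ⟦⟧-count {n} P? Q? =
    trans (length-filter (λ w → P? w ×-dec Q? w) (Perms n)) (∑-cong (Perms n) (λ w → ⟦⟧-× (P? w) (Q? w)))

  ∁-involutive : ∀ {m} (X : Subset m) → ∁ (∁ X) ≡ X
  ∁-involutive []ᵥ       = refl
  ∁-involutive (b ∷ᵥ X) = cong₂ _∷ᵥ_ (not-involutive b) (∁-involutive X)

  ∁-≡-swap : ∀ {m} {X Y : Subset m} → ∁ X ≡ Y → ∁ Y ≡ X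
  ∁-≡-swap {X = X} ∁X≡Y = trans (cong ∁ (sym ∁X≡Y)) (∁-involutive X)

  ∁-⊆-swap : ∀ {m} {X S : Subset m} → ∁ X ⊆ S → ∁ S ⊆ X
  ∁-⊆-swap ∁X⊆S x∈∁S = x∉∁p⇒x∈p (x∈∁p⇒x∉p x∈∁S ∘ ∁X⊆S)

  module _ {m : ℕ} where

    _ᵀ : Mat m → Mat m
    (M ᵀ) S T = M T S

    -- A, B, Γ and B′ all have the form Σ_w R(S, C(w)) · K(T, D(w)); multiplying by ζ acts on
    -- the kernels R and K.
    conDes : Mat m → Mat m → Mat m
    conDes R K S T = ∑[ w ∈ Perms (suc m) ] R S (Con w) * K T (Des w)

    κ∁⊆ κ∁≡ κ⊆ κ≡ : Mat m
    κ∁⊆ S C = ⟦ ∁ S ⊆? C ⟧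
    κ∁≡ S C = ⟦ ∁ S ≟ₛ C ⟧
    κ⊆  T D = ⟦ T ⊆? D ⟧
    κ≡  T D = ⟦ T ≟ₛ D ⟧

    conDes-cong : ∀ {R R′ K K′} → R ≈ R′ → K ≈ K′ → conDes R K ≈ conDes R′ K′
    conDes-cong R≈R′ K≈K′ S T = ∑-cong (Perms (suc m)) (λ w → cong₂ _*_ (R≈R′ S (Con w)) (K≈K′ T (Des w)))

    ⊗-conDes : ∀ M R K → M ⊗ conDes R K ≈ conDes (M ⊗ R) K
    ⊗-conDes M R K S T = begin
      ∑[ U ∈ allSubsets m ] M S U * (∑[ w ∈ Perms (suc m) ] R U (Con w) * K T (Des w))
        ≡⟨ ∑-cong (allSubsets m) (λ U → ∑-*ˡ (Perms (suc m)) (M S U) _) ⟩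
      ∑[ U ∈ allSubsets m ] ∑[ w ∈ Perms (suc m) ] M S U * (R U (Con w) * K T (Des w))
        ≡⟨ ∑-comm (allSubsets m) (Perms (suc m)) _ ⟩
      ∑[ w ∈ Perms (suc m) ] ∑[ U ∈ allSubsets m ] M S U * (R U (Con w) * K T (Des w))
        ≡⟨ ∑-cong (Perms (suc m)) (λ w → ∑-cong (allSubsets m) (λ U → *-assoc (M S U) _ _)) ⟨
      ∑[ w ∈ Perms (suc m) ] ∑[ U ∈ allSubsets m ] M S U * R U (Con w) * K T (Des w)
        ≡⟨ ∑-cong (Perms (suc m)) (λ w → ∑-*ʳ (allSubsets m) (K T (Des w)) _) ⟨
      ∑[ w ∈ Perms (suc m) ] (∑[ U ∈ allSubsets m ] M S U * R U (Con w)) * K T (Des w) ∎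
      where open ≡-Reasoning

    conDes-⊗ : ∀ R K N → conDes R K ⊗ N ≈ conDes R ((N ᵀ) ⊗ K)
    conDes-⊗ R K N S T = begin
      ∑[ V ∈ allSubsets m ] (∑[ w ∈ Perms (suc m) ] R S (Con w) * K V (Des w)) * N V T
        ≡⟨ ∑-cong (allSubsets m) (λ V → ∑-*ʳ (Perms (suc m)) (N V T) _) ⟩
      ∑[ V ∈ allSubsets m ] ∑[ w ∈ Perms (suc m) ] R S (Con w) * K V (Des w) * N V T
        ≡⟨ ∑-comm (allSubsets m) (Perms (suc m)) _ ⟩
      ∑[ w ∈ Perms (suc m) ] ∑[ V ∈ allSubsets m ] R S (Con w) * K V (Des w) * N V T
        ≡⟨ ∑-cong (Perms (suc m)) (λ w → ∑-cong (allSubsets m) (λ V → reorder (R S (Con w)) (K V (Des w)) (N V T))) ⟩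
      ∑[ w ∈ Perms (suc m) ] ∑[ V ∈ allSubsets m ] R S (Con w) * (N V T * K V (Des w))
        ≡⟨ ∑-cong (Perms (suc m)) (λ w → ∑-*ˡ (allSubsets m) (R S (Con w)) _) ⟨
      ∑[ w ∈ Perms (suc m) ] R S (Con w) * (∑[ V ∈ allSubsets m ] N V T * K V (Des w)) ∎
      where
      open ≡-Reasoning
      reorder : ∀ r k n → r * k * n ≡ r * (n * k)
      reorder = solve 3 (λ r k n → r :* k :* n := r :* (n :* k)) refl

    ζ⊗κ∁≡≈κ∁⊆ : ζ ⊗ κ∁≡ ≈ κ∁⊆
    ζ⊗κ∁≡≈κ∁⊆ S C = begin
      ∑[ U ∈ allSubsets m ] ⟦ U ⊆? S ⟧ * ⟦ ∁ U ≟ₛ C ⟧   ≡⟨ ∑-cong (allSubsets m) swap ⟩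
      ∑[ U ∈ allSubsets m ] ⟦ ∁ C ≟ₛ U ⟧ * ⟦ U ⊆? S ⟧   ≡⟨ ∑-subsets-δ (∁ C) (λ U → ⟦ U ⊆? S ⟧) ⟩
      ⟦ ∁ C ⊆? S ⟧                                      ≡⟨ ⟦⟧-cong ∁-⊆-swap ∁-⊆-swap (∁ C ⊆? S) (∁ S ⊆? C) ⟩
      ⟦ ∁ S ⊆? C ⟧                                      ∎
      where
      open ≡-Reasoning
      swap : ∀ U → ⟦ U ⊆? S ⟧ * ⟦ ∁ U ≟ₛ C ⟧ ≡ ⟦ ∁ C ≟ₛ U ⟧ * ⟦ U ⊆? S ⟧
      swap U = trans (*-comm ⟦ U ⊆? S ⟧ _)
                     (cong (_* ⟦ U ⊆? S ⟧) (⟦⟧-cong ∁-≡-swap ∁-≡-swap (∁ U ≟ₛ C) (∁ C ≟ₛ U)))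

    ζᵀ⊗κ≡≈κ⊆ : (ζ ᵀ) ⊗ κ≡ ≈ κ⊆
    ζᵀ⊗κ≡≈κ⊆ T D = trans (∑-cong (allSubsets m) swap) (∑-subsets-δ D (λ V → ⟦ T ⊆? V ⟧))
      where
      swap : ∀ V → ⟦ T ⊆? V ⟧ * ⟦ V ≟ₛ D ⟧ ≡ ⟦ D ≟ₛ V ⟧ * ⟦ T ⊆? V ⟧
      swap V = trans (*-comm ⟦ T ⊆? V ⟧ _) (cong (_* ⟦ T ⊆? V ⟧) (⟦≟⟧-sym V D))

  module _ (m : ℕ) where

    B′ : Mat m
    B′ S T = + countPerms {suc m} (λ w → (∁ S ≟ₛ Con w) ×-dec (T ⊆? Des w))

    A≈conDes : A m ≈ conDes κ∁⊆ κ⊆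
    A≈conDes S T = ⟦⟧-count (λ w → ∁ S ⊆? Con w) (λ w → T ⊆? Des w)

    B≈conDes : B m ≈ conDes κ∁⊆ κ≡
    B≈conDes S T = ⟦⟧-count (λ w → ∁ S ⊆? Con w) (λ w → T ≟ₛ Des w)

    B′≈conDes : B′ ≈ conDes κ∁≡ κ⊆
    B′≈conDes S T = ⟦⟧-count (λ w → ∁ S ≟ₛ Con w) (λ w → T ⊆? Des w)

    Γ≈conDes : Γ m ≈ conDes κ∁≡ κ≡
    Γ≈conDes S T = trans (⟦⟧-count (λ w → Con w ≟ₛ ∁ S) (λ w → Des w ≟ₛ T))
      (∑-cong (Perms (suc m)) (λ w → cong₂ _*_ (⟦≟⟧-sym (Con w) (∁ S)) (⟦≟⟧-sym (Des w) T)))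

    B≈ζ⊗Γ : B m ≈ ζ ⊗ Γ m
    B≈ζ⊗Γ = begin
      B m                  ≈⟨ B≈conDes ⟩
      conDes κ∁⊆ κ≡        ≈⟨ conDes-cong (≈-sym ζ⊗κ∁≡≈κ∁⊆) (≈-refl {M = κ≡}) ⟩
      conDes (ζ ⊗ κ∁≡) κ≡  ≈⟨ ⊗-conDes ζ κ∁≡ κ≡ ⟨
      ζ ⊗ conDes κ∁≡ κ≡    ≈⟨ ⊗-cong (≈-refl {M = ζ}) Γ≈conDes ⟨
      ζ ⊗ Γ m              ∎
      where open ≈-Reasoning

    B′≈Γ⊗ζ : B′ ≈ Γ m ⊗ ζ
    B′≈Γ⊗ζ = begin
      B′                       ≈⟨ B′≈conDes ⟩
      conDes κ∁≡ κ⊆            ≈⟨ conDes-cong (≈-refl {M = κ∁≡}) (≈-sym ζᵀ⊗κ≡≈κ⊆) ⟩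
      conDes κ∁≡ ((ζ ᵀ) ⊗ κ≡)  ≈⟨ conDes-⊗ κ∁≡ κ≡ ζ ⟨
      conDes κ∁≡ κ≡ ⊗ ζ        ≈⟨ ⊗-cong Γ≈conDes (≈-refl {M = ζ}) ⟨
      Γ m ⊗ ζ                  ∎
      where open ≈-Reasoning

    A≈ζ⊗B′ : A m ≈ ζ ⊗ B′
    A≈ζ⊗B′ = begin
      A m                  ≈⟨ A≈conDes ⟩
      conDes κ∁⊆ κ⊆        ≈⟨ conDes-cong (≈-sym ζ⊗κ∁≡≈κ∁⊆) (≈-refl {M = κ⊆}) ⟩
      conDes (ζ ⊗ κ∁≡) κ⊆  ≈⟨ ⊗-conDes ζ κ∁≡ κ⊆ ⟨
      ζ ⊗ conDes κ∁≡ κ⊆    ≈⟨ ⊗-cong (≈-refl {M = ζ}) B′≈conDes ⟨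
      ζ ⊗ B′               ∎
      where open ≈-Reasoning

    A-multiplicative : ∀ S U T → A m S U * A m U T ≡ ζ S U * ζ U T * A m S T
    A-multiplicative S U T with U ⊆? S | T ⊆? U
    ... | yes U⊆S | yes T⊆U = begin
      A m S U * A m U T        ≡⟨ pos-* (α m S U) (α m U T) ⟨
      + (α m S U ℕ.* α m U T)  ≡⟨ cong +_ (α-multiplicative S U T T⊆U U⊆S) ⟩
      A m S T                  ≡⟨ *-identityˡ (A m S T) ⟨
      + 1 * + 1 * A m S T      ∎
      where open ≡-Reasoning
    ... | no U⊈S | _ = cong (_* A m U T) (cong +_ (α-vanishes S U U⊈S))
    ... | yes _ | no T⊈U = trans (cong (A m S U *_) (cong +_ (α-vanishes U T T⊈U))) (*-zeroʳ (A m S U))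

    A⊗Sgn⊗A≈Sgn : A m ⊗ (Sgn ⊗ A m) ≈ Sgn
    A⊗Sgn⊗A≈Sgn S T = begin
      ∑[ U ∈ allSubsets m ] A m S U * (Sgn ⊗ A m) U T
        ≡⟨ ∑-cong (allSubsets m) (λ U → cong (A m S U *_) (Sgn-⊗ (A m) U T)) ⟩
      ∑[ U ∈ allSubsets m ] A m S U * (sg U * A m U T)
        ≡⟨ ∑-cong (allSubsets m) reorder ⟩
      ∑[ U ∈ allSubsets m ] ζ S U * (sg U * ζ U T) * A m S T
        ≡⟨ ∑-*ʳ (allSubsets m) (A m S T) _ ⟨
      (∑[ U ∈ allSubsets m ] ζ S U * (sg U * ζ U T)) * A m S T
        ≡⟨ cong (_* A m S T) (möbius S T) ⟩
      Sgn S T * A m S T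
        ≡⟨ Sgn-*-diagonal (A m) (λ S → cong +_ (α-diagonal S)) S T ⟩
      Sgn S T ∎
      where
      open ≡-Reasoning
      reorder : ∀ U → A m S U * (sg U * A m U T) ≡ ζ S U * (sg U * ζ U T) * A m S T
      reorder U = begin
        A m S U * (sg U * A m U T)
          ≡⟨ solve 3 (λ a s b → a :* (s :* b) := s :* (a :* b)) refl (A m S U) (sg U) (A m U T) ⟩
        sg U * (A m S U * A m U T)
          ≡⟨ cong (sg U *_) (A-multiplicative S U T) ⟩
        sg U * (ζ S U * ζ U T * A m S T)
          ≡⟨ solve 4 (λ s z z′ a → s :* (z :* z′ :* a) := z :* (s :* z′) :* a) refl (sg U) (ζ S U) (ζ U T) (A m S T) ⟩
        ζ S U * (sg U * ζ U T) * A m S T ∎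

    Γ⊗Sgn⊗Γ≈Sgn : Γ m ⊗ (Sgn ⊗ Γ m) ≈ Sgn
    Γ⊗Sgn⊗Γ≈Sgn = twisted-conjugate Mat-monoid Sgn⊗Sgn≈Id {Z = ζ} ζ⊗Sgn⊗ζ≈Sgn {X = A m} {Y = Γ m}
      (≈-trans A≈ζ⊗B′ (⊗-cong (≈-refl {M = ζ}) B′≈Γ⊗ζ)) A⊗Sgn⊗A≈Sgn

    B⊗Sgn⊗B′≈Sgn : B m ⊗ (Sgn ⊗ B′) ≈ Sgn
    B⊗Sgn⊗B′≈Sgn = ≈-trans (⊗-cong B≈ζ⊗Γ (⊗-cong (≈-refl {M = Sgn}) B′≈Γ⊗ζ))
      (proj₁ (twisted-factors Mat-monoid Sgn⊗Sgn≈Id {Z = ζ} ζ⊗Sgn⊗ζ≈Sgn {Y = Γ m} Γ⊗Sgn⊗Γ≈Sgn))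

    B′⊗Sgn⊗B≈Sgn : B′ ⊗ (Sgn ⊗ B m) ≈ Sgn
    B′⊗Sgn⊗B≈Sgn = ≈-trans (⊗-cong B′≈Γ⊗ζ (⊗-cong (≈-refl {M = Sgn}) B≈ζ⊗Γ))
      (proj₂ (twisted-factors Mat-monoid Sgn⊗Sgn≈Id {Z = ζ} ζ⊗Sgn⊗ζ≈Sgn {Y = Γ m} Γ⊗Sgn⊗Γ≈Sgn))

  inverse-by-twisting : ∀ {m} {X Y : Mat m} → X ⊗ (Sgn ⊗ Y) ≈ Sgn → Y ⊗ (Sgn ⊗ X) ≈ Sgn →
                        IsInverseOf X (λ S T → sgn S T * Y S T)
  inverse-by-twisting {X = X} {Y} XSY≈Sgn YSX≈Sgn =
    let right , left = twisted-inverse Mat-monoid Sgn⊗Sgn≈Id {X = X} {Y = Y} XSY≈Sgn YSX≈Sgn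
    in ≈-trans (⊗-cong (≈-refl {M = X}) (sgn-twist Y)) right
     , ≈-trans (⊗-cong (sgn-twist Y) (≈-refl {M = X})) left

open StatisticMatrices

theorem1p4 : (m : ℕ) →
    IsInverseOf (A m) (Ainv m) × IsInverseOf (B m) (Binv m) × IsInverseOf (Γ m) (Γinv m)
theorem1p4 m = inverse-by-twisting (A⊗Sgn⊗A≈Sgn m) (A⊗Sgn⊗A≈Sgn m)
             , inverse-by-twisting (B⊗Sgn⊗B′≈Sgn m) (B′⊗Sgn⊗B≈Sgn m)
             , inverse-by-twisting (Γ⊗Sgn⊗Γ≈Sgn m) (Γ⊗Sgn⊗Γ≈Sgn m)
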